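{- Let $G$ be a subgraph of an $n$-node graph with node identifiers in $[n]$, let $\ell$ be sufficiently large with $\ell^{0.1}$ an integer, and assume every node $v$ of $G$ has degree $d(v)\le \ell+\ell^{0.7}$ in $G$. Let $h_1$ be chosen uniformly at random from a $c$-wise independent family of hash functions $[n]\to[\ell^{0.1}]$, for a sufficiently large constant $c$. Then for every node $v$, the probability that $|d'(v)-d(v)\ell^{ -0.1}|\ge \ell^{0.6}$ is at most $\ell^{ -3}$, where $d'(v)$ is the number of neighbors $u$ of $v$ in $G$ with $h_1(u)=h_1(v)$.
   Context: A family $\mathcal H$ of functions $[N]\to[L]$ is $c$-wise independent if for all distinct $x_1,\dots,x_c\in[N]$, the values $h(x_1),\dots,h(x_c)$ are independent and uniformly distributed in $[L]$ when $h$ is uniform from $\mathcal H$. -}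

module Defs where

open import Data.Nat using (ℕ; zero; suc; _+_; _*_; _^_; _≤_)
open import Data.Bool using (Bool; true; false; if_then_else_; _∧_)
open import Data.Fin using (Fin; zero; suc; _≟_)
open import Data.Integer using (ℤ; +_; _-_; ∣_∣)
open import Relation.Nullary.Decidable using (⌊_⌋)
open import Relation.Binary.PropositionalEquality using (_≡_)
open import Function.Definitions using (Injective)

count : ∀ {K : ℕ} → (Fin K → Bool) → ℕ
count {zero}  P = 0
count {suc K} P = (if P zero then 1 else 0) + count {K} (λ i → P (suc i))

_==_ : ∀ {m} → Fin m → Fin m → Bool
a == b = ⌊ a ≟ b ⌋

allFin : ∀ {c : ℕ} → (Fin c → Bool) → Bool
allFin {zero}  P = true
allFin {suc c} P = P zero ∧ allFin {c} (λ j → P (suc j))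

-- A simple (undirected, loopless) graph on node identifiers [n] = Fin n.
-- (A subgraph of an n-node graph with ids in [n] is modelled as a graph on
--  Fin n; nodes outside the subgraph are isolated.)
record Graph (n : ℕ) : Set where
  field
    adj   : Fin n → Fin n → Bool
    sym   : ∀ u v → adj u v ≡ adj v u
    irrefl : ∀ v → adj v v ≡ false
open Graph public

degree : ∀ {n} → Graph n → Fin n → ℕ
degree G v = count (adj G v)

degree' : ∀ {n m} → Graph n → (Fin n → Fin m) → Fin n → ℕ
degree' G h v = count (λ u → adj G v u ∧ (h u == h v))

-- A hash family is a finite nonempty multiset of functions, given as an
-- indexing Fin K → (Fin n → Fin L); "uniform from H" = uniform index.
-- c-wise independence: for every injective x : Fin c → Fin n and every
-- y : Fin c → Fin L, Pr[∀ j, h (x j) = y j] = L^{-c}, i.e.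
-- #{i | ∀ j, H i (x j) = y j} * L^c = K.
CWiseIndependent : (c : ℕ) {n L K : ℕ} → (Fin K → Fin n → Fin L) → Set
CWiseIndependent c {n} {L} {K} H =
  (x : Fin c → Fin n) → Injective _≡_ _≡_ x →
  (y : Fin c → Fin L) →
  count (λ i → allFin (λ j → H i (x j) == y j)) * L ^ c ≡ K

-- |d'(v) - d(v)/m| ≥ m^6, multiplied through by m > 0:
-- |d'(v)·m - d(v)| ≥ m^7   (here m = ℓ^{0.1})
Deviates : (m d d' : ℕ) → Bool
Deviates m d d' = ⌊ m ^ 7 Data.Nat.≤? ∣ (+ (d' * m)) - (+ d) ∣ ⌋

-- Fix v, write m = ℓ^0.1, X = d′(v) and Z = m·X − d, so that `Deviates` says |Z| ≥ m⁷.
-- The hash of v and of any j ≤ 22 distinct neighbours of v are independent and uniform,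
-- so the factorial moments of X are those of a Binomial(d, 1/m) variable:
-- E[(X)_j] · m^j = (d)_j.  Z²² is a polynomial of degree 22 in X, hence E[Z²²] equals
-- the 22nd central moment of m·Binomial(d, 1/m), which is at most κ·(m(d+m))¹¹ = O(m¹²¹).
-- Markov's inequality for Z²² ≥ m¹⁵⁴ then bounds the deviation probability by m⁻³⁰ = ℓ⁻³.

module Submission where

open import Defs hiding (sym)
open import Data.Nat using (ℕ)

module Counting where

  open import Data.Nat using (ℕ; zero; suc; _+_; _*_; _≤_; z≤n; s≤s)
  open import Data.Nat.Properties
    using (+-*-semiring; +-identityʳ; *-identityˡ; *-zeroʳ; m≤n⇒m≤1+n; +-mono-≤; ≤-trans; ≤-reflexive; module ≤-Reasoning)
  open import Data.Bool using (Bool; true; false; if_then_else_; _∧_)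
  open import Data.Fin using (Fin; zero; suc; _≟_)
  open import Data.Fin.Properties using (suc-injective)
  open import Data.Empty using (⊥-elim)
  open import Data.Product using (_×_; _,_)
  open import Relation.Nullary using (yes; no)
  open import Relation.Nullary.Decidable using (⌊⌋-map′)
  open import Relation.Binary.PropositionalEquality
  open import Algebra.Properties.Semiring.Sum +-*-semiring public
    using (sum; sum-syntax; sum-cong-≗; ∑-distrib-+; ∑-comm; *-distribˡ-sum; *-distribʳ-sum; sum-init-last)

  𝟙 : Bool → ℕ
  𝟙 b = if b then 1 else 0

  𝟙-∧ : ∀ a b → 𝟙 (a ∧ b) ≡ 𝟙 a * 𝟙 b
  𝟙-∧ true  b = sym (+-identityʳ (𝟙 b))
  𝟙-∧ false b = refl

  count≡sum𝟙 : ∀ {N} (P : Fin N → Bool) → count P ≡ ∑[ i < N ] 𝟙 (P i)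
  count≡sum𝟙 {zero}  P = refl
  count≡sum𝟙 {suc N} P = cong (𝟙 (P zero) +_) (count≡sum𝟙 (λ i → P (suc i)))

  count-cong : ∀ {N} {P Q : Fin N → Bool} → (∀ i → P i ≡ Q i) → count P ≡ count Q
  count-cong {zero}  eq = refl
  count-cong {suc N} eq = cong₂ (λ b n → 𝟙 b + n) (eq zero) (count-cong (λ i → eq (suc i)))

  count≤size : ∀ {N} (P : Fin N → Bool) → count P ≤ N
  count≤size {zero}  P = z≤n
  count≤size {suc N} P with P zero
  ... | true  = s≤s (count≤size (λ i → P (suc i)))
  ... | false = m≤n⇒m≤1+n (count≤size (λ i → P (suc i)))

  ∧-true⁻ : ∀ a b → a ∧ b ≡ true → a ≡ true × b ≡ true
  ∧-true⁻ true b b≡true = refl , b≡true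

  sum-const : ∀ N c → ∑[ _ < N ] c ≡ N * c
  sum-const zero    c = refl
  sum-const (suc N) c = cong (c +_) (sum-const N c)

  sum-zero : ∀ {N} {f : Fin N → ℕ} → (∀ i → f i ≡ 0) → sum f ≡ 0
  sum-zero {N} f≡0 = trans (sum-cong-≗ f≡0) (trans (sum-const N 0) (*-zeroʳ N))

  sum-mono-≤ : ∀ {N} {f g : Fin N → ℕ} → (∀ i → f i ≤ g i) → sum f ≤ sum g
  sum-mono-≤ {zero}  f≤g = z≤n
  sum-mono-≤ {suc N} f≤g = +-mono-≤ (f≤g zero) (sum-mono-≤ (λ i → f≤g (suc i)))

  count-none : ∀ {N} (P : Fin N → Bool) → (∀ i → P i ≡ false) → count P ≡ 0
  count-none P none = trans (count≡sum𝟙 P) (sum-zero (λ i → cong 𝟙 (none i)))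

  count-markov : ∀ {N} (P : Fin N → Bool) (f : Fin N → ℕ) a →
                 (∀ i → P i ≡ true → a ≤ f i) → count P * a ≤ ∑[ i < N ] f i
  count-markov {N} P f a P⇒a≤f = begin
    count P * a               ≡⟨ cong (_* a) (count≡sum𝟙 P) ⟩
    (∑[ i < N ] 𝟙 (P i)) * a  ≡⟨ *-distribʳ-sum a (λ i → 𝟙 (P i)) ⟩
    ∑[ i < N ] (𝟙 (P i) * a)  ≤⟨ sum-mono-≤ pointwise ⟩
    ∑[ i < N ] f i            ∎
    where
      open ≤-Reasoning
      pointwise : ∀ i → 𝟙 (P i) * a ≤ f i
      pointwise i with P i in Pi
      ... | true  = ≤-trans (≤-reflexive (*-identityˡ a)) (P⇒a≤f i Pi)
      ... | false = z≤n

  ==-complete : ∀ {n} {a b : Fin n} → a ≡ b → (a == b) ≡ true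
  ==-complete {a = a} {b} a≡b with a ≟ b
  ... | yes _  = refl
  ... | no a≢b = ⊥-elim (a≢b a≡b)

  ==-sound : ∀ {n} {a b : Fin n} → (a == b) ≡ true → a ≡ b
  ==-sound {a = a} {b} eq with a ≟ b
  ... | yes a≡b = a≡b

  ==-sym : ∀ {n} (a b : Fin n) → (a == b) ≡ (b == a)
  ==-sym a b with a ≟ b | b ≟ a
  ... | yes _   | yes _   = refl
  ... | no _    | no _    = refl
  ... | yes a≡b | no b≢a  = ⊥-elim (b≢a (sym a≡b))
  ... | no a≢b  | yes b≡a = ⊥-elim (a≢b (sym b≡a))

  suc==suc : ∀ {n} (a b : Fin n) → (suc a == suc b) ≡ (a == b)
  suc==suc a b = ⌊⌋-map′ (cong suc) suc-injective (a ≟ b)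

  sum𝟙[a==_]≡1 : ∀ {N} (a : Fin N) → ∑[ w < N ] 𝟙 (a == w) ≡ 1
  sum𝟙[a==_]≡1 {suc N} zero    = cong suc (sum-zero {N} (λ _ → refl))
  sum𝟙[a==_]≡1 {suc N} (suc a) = trans (sum-cong-≗ (λ w → cong 𝟙 (suc==suc a w))) (sum𝟙[a==_]≡1 a)

  count-by-value : ∀ {N M} (g : Fin N → Fin M) (Q : Fin N → Bool) →
                   count Q ≡ ∑[ w < M ] count (λ i → (g i == w) ∧ Q i)
  count-by-value {N} {M} g Q = begin
    count Q                                        ≡⟨ count≡sum𝟙 Q ⟩
    ∑[ i < N ] 𝟙 (Q i)                             ≡⟨ sum-cong-≗ (λ i → sym (split i)) ⟩
    ∑[ i < N ] ∑[ w < M ] 𝟙 ((g i == w) ∧ Q i)     ≡⟨ ∑-comm (λ i w → 𝟙 ((g i == w) ∧ Q i)) ⟩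
    ∑[ w < M ] ∑[ i < N ] 𝟙 ((g i == w) ∧ Q i)     ≡⟨ sum-cong-≗ (λ w → sym (count≡sum𝟙 (λ i → (g i == w) ∧ Q i))) ⟩
    ∑[ w < M ] count (λ i → (g i == w) ∧ Q i)      ∎
    where
      open ≡-Reasoning
      split : ∀ i → ∑[ w < M ] 𝟙 ((g i == w) ∧ Q i) ≡ 𝟙 (Q i)
      split i = begin
        ∑[ w < M ] 𝟙 ((g i == w) ∧ Q i)     ≡⟨ sum-cong-≗ (λ w → 𝟙-∧ (g i == w) (Q i)) ⟩
        ∑[ w < M ] (𝟙 (g i == w) * 𝟙 (Q i)) ≡⟨ *-distribʳ-sum (𝟙 (Q i)) (λ w → 𝟙 (g i == w)) ⟨
        (∑[ w < M ] 𝟙 (g i == w)) * 𝟙 (Q i) ≡⟨ cong (_* 𝟙 (Q i)) (sum𝟙[a==_]≡1 (g i)) ⟩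
        1 * 𝟙 (Q i)                          ≡⟨ *-identityˡ (𝟙 (Q i)) ⟩
        𝟙 (Q i)                              ∎

module DistinctTuples where

  open Counting
  open import Data.Nat using (ℕ; zero; suc; _+_; _*_; _∸_; _<_)
  open import Data.Nat.Properties using (+-assoc; *-comm; m+n∸n≡m; +-identityʳ)
  open import Data.Nat.Combinatorics.Base using (_P′_)
  open import Data.Bool using (Bool; true; false; not; _∧_)
  open import Data.Bool.Properties using (∧-assoc; ∧-comm; ∧-commutativeMonoid; ¬-not)
    renaming (_≟_ to _≟ᴮ_)
  open import Algebra.Bundles using (CommutativeMonoid)
  open import Algebra.Properties.CommutativeSemigroup
    (CommutativeMonoid.commutativeSemigroup ∧-commutativeMonoid) using (interchange)
  open import Data.Fin as Fin using (Fin; zero; suc)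
  open import Data.Fin.Properties using (any?; pigeonhole; <-irrefl)
  open import Data.Vec using (Vec; []; _∷_; lookup)
  open import Data.Product using (∃; ∃₂; _×_; _,_; proj₁; proj₂)
  open import Data.Empty using (⊥-elim)
  open import Relation.Nullary using (yes; no; ¬_)
  open import Relation.Binary.PropositionalEquality
  open import Function.Definitions using (Injective)

  fresh : ∀ {n j} → Fin n → Vec (Fin n) j → Bool
  fresh a []      = true
  fresh a (u ∷ t) = not (a == u) ∧ fresh a t

  distinct : ∀ {n j} → Vec (Fin n) j → Bool
  distinct []      = true
  distinct (u ∷ t) = fresh u t ∧ distinct t

  every : ∀ {n j} → (Fin n → Bool) → Vec (Fin n) j → Bool
  every P []      = true
  every P (u ∷ t) = P u ∧ every P t

  ∑ⱽ : ∀ {n} j → (Vec (Fin n) j → ℕ) → ℕ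
  ∑ⱽ     zero    f = f []
  ∑ⱽ {n} (suc j) f = ∑[ a < n ] ∑ⱽ j (λ t → f (a ∷ t))

  ∑ⱽ-cong : ∀ {n} j {f g : Vec (Fin n) j → ℕ} → (∀ t → f t ≡ g t) → ∑ⱽ j f ≡ ∑ⱽ j g
  ∑ⱽ-cong zero    f≡g = f≡g []
  ∑ⱽ-cong (suc j) f≡g = sum-cong-≗ (λ a → ∑ⱽ-cong j (λ t → f≡g (a ∷ t)))

  ∑ⱽ-distribʳ : ∀ {n} j (f : Vec (Fin n) j → ℕ) c → ∑ⱽ j (λ t → f t * c) ≡ ∑ⱽ j f * c
  ∑ⱽ-distribʳ zero    f c = refl
  ∑ⱽ-distribʳ (suc j) f c =
    trans (sum-cong-≗ (λ a → ∑ⱽ-distribʳ j (λ t → f (a ∷ t)) c))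
          (sym (*-distribʳ-sum c (λ a → ∑ⱽ j (λ t → f (a ∷ t)))))

  ∑-∑ⱽ-comm : ∀ {N n} j (f : Fin N → Vec (Fin n) j → ℕ) →
              ∑[ i < N ] ∑ⱽ j (f i) ≡ ∑ⱽ j (λ t → ∑[ i < N ] f i t)
  ∑-∑ⱽ-comm zero    f = refl
  ∑-∑ⱽ-comm (suc j) f =
    trans (∑-comm (λ i a → ∑ⱽ j (λ t → f i (a ∷ t))))
          (sum-cong-≗ (λ a → ∑-∑ⱽ-comm j (λ i t → f i (a ∷ t))))

  count-remove : ∀ {N} (Q : Fin N → Bool) u → Q u ≡ true →
                 count (λ a → not (a == u) ∧ Q a) + 1 ≡ count Q
  count-remove {N} Q u Qu = begin
    count (λ a → not (a == u) ∧ Q a) + 1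
      ≡⟨ cong₂ _+_ (count≡sum𝟙 (λ a → not (a == u) ∧ Q a)) (sym (sum𝟙[a==_]≡1 u)) ⟩
    ∑[ a < N ] 𝟙 (not (a == u) ∧ Q a) + ∑[ a < N ] 𝟙 (u == a)
      ≡⟨ ∑-distrib-+ (λ a → 𝟙 (not (a == u) ∧ Q a)) (λ a → 𝟙 (u == a)) ⟨
    ∑[ a < N ] (𝟙 (not (a == u) ∧ Q a) + 𝟙 (u == a))
      ≡⟨ sum-cong-≗ split ⟩
    ∑[ a < N ] 𝟙 (Q a)
      ≡⟨ count≡sum𝟙 Q ⟨
    count Q ∎
    where
      open ≡-Reasoning
      split : ∀ a → 𝟙 (not (a == u) ∧ Q a) + 𝟙 (u == a) ≡ 𝟙 (Q a)
      split a rewrite ==-sym u a with a Fin.≟ u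
      ... | yes refl = cong 𝟙 (sym Qu)
      ... | no _     = +-identityʳ (𝟙 (Q a))

  count-fresh : ∀ {n j} (P : Fin n → Bool) (t : Vec (Fin n) j) →
                distinct t ≡ true → every P t ≡ true → count (λ a → fresh a t ∧ P a) + j ≡ count P
  count-fresh P [] _ _ = +-identityʳ (count P)
  count-fresh {j = suc j} P (u ∷ t) dist all
    with ∧-true⁻ (fresh u t) (distinct t) dist | ∧-true⁻ (P u) (every P t) all
  ... | u∉t , t-distinct | Pu , t-all = begin
    count (λ a → fresh a (u ∷ t) ∧ P a) + (1 + j)
      ≡⟨ cong (_+ (1 + j)) (count-cong (λ a → ∧-assoc (not (a == u)) (fresh a t) (P a))) ⟩
    count (λ a → not (a == u) ∧ (fresh a t ∧ P a)) + (1 + j)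
      ≡⟨ +-assoc _ 1 j ⟨
    count (λ a → not (a == u) ∧ (fresh a t ∧ P a)) + 1 + j
      ≡⟨ cong (_+ j) (count-remove (λ a → fresh a t ∧ P a) u (cong₂ _∧_ u∉t Pu)) ⟩
    count (λ a → fresh a t ∧ P a) + j
      ≡⟨ count-fresh P t t-distinct t-all ⟩
    count P ∎
    where open ≡-Reasoning

  ∑ⱽ-distinct-every : ∀ {n} (P : Fin n → Bool) j →
                      ∑ⱽ j (λ t → 𝟙 (distinct t ∧ every P t)) ≡ count P P′ j
  ∑ⱽ-distinct-every P zero = refl
  ∑ⱽ-distinct-every {n} P (suc j) = begin
    ∑[ a < n ] ∑ⱽ j (λ t → 𝟙 ((fresh a t ∧ distinct t) ∧ (P a ∧ every P t)))
      ≡⟨ sum-cong-≗ (λ a → ∑ⱽ-cong j (λ t → split a t)) ⟩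
    ∑[ a < n ] ∑ⱽ j (λ t → 𝟙 (distinct t ∧ every P t) * 𝟙 (fresh a t ∧ P a))
      ≡⟨ ∑-∑ⱽ-comm j (λ a t → 𝟙 (distinct t ∧ every P t) * 𝟙 (fresh a t ∧ P a)) ⟩
    ∑ⱽ j (λ t → ∑[ a < n ] (𝟙 (distinct t ∧ every P t) * 𝟙 (fresh a t ∧ P a)))
      ≡⟨ ∑ⱽ-cong j (λ t → sym (*-distribˡ-sum (𝟙 (distinct t ∧ every P t)) (λ a → 𝟙 (fresh a t ∧ P a)))) ⟩
    ∑ⱽ j (λ t → 𝟙 (distinct t ∧ every P t) * ∑[ a < n ] 𝟙 (fresh a t ∧ P a))
      ≡⟨ ∑ⱽ-cong j fresh-choices ⟩
    ∑ⱽ j (λ t → 𝟙 (distinct t ∧ every P t) * (count P ∸ j))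
      ≡⟨ ∑ⱽ-distribʳ j (λ t → 𝟙 (distinct t ∧ every P t)) (count P ∸ j) ⟩
    ∑ⱽ j (λ t → 𝟙 (distinct t ∧ every P t)) * (count P ∸ j)
      ≡⟨ cong (_* (count P ∸ j)) (∑ⱽ-distinct-every P j) ⟩
    (count P P′ j) * (count P ∸ j)
      ≡⟨ *-comm (count P P′ j) (count P ∸ j) ⟩
    count P P′ suc j ∎
    where
      open ≡-Reasoning
      split : ∀ a t → 𝟙 ((fresh a t ∧ distinct t) ∧ (P a ∧ every P t))
                      ≡ 𝟙 (distinct t ∧ every P t) * 𝟙 (fresh a t ∧ P a)
      split a t = begin
        𝟙 ((fresh a t ∧ distinct t) ∧ (P a ∧ every P t))
          ≡⟨ cong 𝟙 (interchange (fresh a t) (distinct t) (P a) (every P t)) ⟩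
        𝟙 ((fresh a t ∧ P a) ∧ (distinct t ∧ every P t))
          ≡⟨ cong 𝟙 (∧-comm (fresh a t ∧ P a) (distinct t ∧ every P t)) ⟩
        𝟙 ((distinct t ∧ every P t) ∧ (fresh a t ∧ P a))
          ≡⟨ 𝟙-∧ (distinct t ∧ every P t) (fresh a t ∧ P a) ⟩
        𝟙 (distinct t ∧ every P t) * 𝟙 (fresh a t ∧ P a) ∎
      fresh-choices : ∀ t → 𝟙 (distinct t ∧ every P t) * ∑[ a < n ] 𝟙 (fresh a t ∧ P a)
                            ≡ 𝟙 (distinct t ∧ every P t) * (count P ∸ j)
      fresh-choices t with distinct t in dist | every P t in all
      ... | false | _     = refl
      ... | true  | false = refl
      ... | true  | true  = cong (1 *_) (begin
        ∑[ a < n ] 𝟙 (fresh a t ∧ P a)        ≡⟨ count≡sum𝟙 (λ a → fresh a t ∧ P a) ⟨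
        count (λ a → fresh a t ∧ P a)         ≡⟨ m+n∸n≡m _ j ⟨
        count (λ a → fresh a t ∧ P a) + j ∸ j ≡⟨ cong (_∸ j) (count-fresh P t dist all) ⟩
        count P ∸ j                            ∎)

  every-∧ : ∀ {n j} (P Q : Fin n → Bool) (t : Vec (Fin n) j) →
            every (λ u → P u ∧ Q u) t ≡ every P t ∧ every Q t
  every-∧ P Q []      = refl
  every-∧ P Q (u ∷ t) = trans (cong ((P u ∧ Q u) ∧_) (every-∧ P Q t)) (interchange (P u) (Q u) (every P t) (every Q t))

  position : ∀ {n j} (a : Fin n) (t : Vec (Fin n) j) → fresh a t ≡ false → ∃ λ k → lookup t k ≡ a
  position a (u ∷ t) a∈t with a == u in a==u
  ... | true  = zero , sym (==-sound a==u)
  ... | false = let k , tₖ≡a = position a t a∈t in suc k , tₖ≡a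

  fresh-exists : ∀ {n j} → j < n → (t : Vec (Fin n) j) → ∃ λ a → fresh a t ≡ true
  fresh-exists {n} j<n t with any? (λ a → fresh a t ≟ᴮ true)
  ... | yes found = found
  ... | no none   = ⊥-elim (no-collision (pigeonhole j<n index))
    where
      occurs : ∀ a → fresh a t ≡ false
      occurs a = ¬-not (λ fresh-a → none (a , fresh-a))
      index : Fin n → Fin _
      index a = proj₁ (position a t (occurs a))
      index-injective : ∀ a b → index a ≡ index b → a ≡ b
      index-injective a b eq = trans (sym (proj₂ (position a t (occurs a))))
                                     (trans (cong (lookup t) eq) (proj₂ (position b t (occurs b))))
      no-collision : ¬ (∃₂ λ a b → a Fin.< b × index a ≡ index b)
      no-collision (a , b , a<b , eq) = <-irrefl (index-injective a b eq) a<b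

  fresh⇒lookup≢ : ∀ {n j} {a : Fin n} (t : Vec (Fin n) j) → fresh a t ≡ true → ∀ k → lookup t k ≢ a
  fresh⇒lookup≢ (u ∷ t) u∉t zero refl with () ← trans (sym u∉t) (cong (λ b → not b ∧ fresh u t) (==-complete refl))
  fresh⇒lookup≢ (u ∷ t) a∉t (suc k) tₖ≡a = fresh⇒lookup≢ t (proj₂ (∧-true⁻ _ (fresh _ t) a∉t)) k tₖ≡a

  distinct⇒injective : ∀ {n j} (t : Vec (Fin n) j) → distinct t ≡ true → Injective _≡_ _≡_ (lookup t)
  distinct⇒injective (u ∷ t) dist {zero}  {zero}  eq = refl
  distinct⇒injective (u ∷ t) dist {zero}  {suc b} eq =
    ⊥-elim (fresh⇒lookup≢ t (proj₁ (∧-true⁻ _ _ dist)) b (sym eq))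
  distinct⇒injective (u ∷ t) dist {suc a} {zero}  eq =
    ⊥-elim (fresh⇒lookup≢ t (proj₁ (∧-true⁻ _ _ dist)) a eq)
  distinct⇒injective (u ∷ t) dist {suc a} {suc b} eq =
    cong suc (distinct⇒injective t (proj₂ (∧-true⁻ (fresh u t) _ dist)) eq)

module Independence where

  open Counting
  open DistinctTuples
  open import Data.Nat using (ℕ; zero; suc; _+_; _*_; _^_; _≤_; _<_; _∸_; z≤n; s≤s; NonZero)
  open import Data.Nat.Properties
    using (*-cancelˡ-≡; *-commutativeSemigroup; +-identityʳ; +-suc; m<m+n; <-≤-trans; ≤-trans; ≤-reflexive; m+[n∸m]≡n)
  open import Data.Bool using (Bool; true; false; _∧_)
  open import Data.Fin using (Fin; zero; suc)
  open import Data.Vec using (Vec; []; _∷_; lookup; replicate)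
  open import Data.Product using (_,_)
  open import Relation.Binary.PropositionalEquality
  open import Algebra.Properties.CommutativeSemigroup *-commutativeSemigroup using (x∙yz≈y∙xz)

  matches : ∀ {n m j} → (Fin n → Fin m) → Vec (Fin n) j → Vec (Fin m) j → Bool
  matches h []       []       = true
  matches h (x ∷ xs) (y ∷ ys) = (h x == y) ∧ matches h xs ys

  allFin-lookup≡matches : ∀ {n m j} (h : Fin n → Fin m) (xs : Vec (Fin n) j) (ys : Vec (Fin m) j) →
                          allFin (λ k → h (lookup xs k) == lookup ys k) ≡ matches h xs ys
  allFin-lookup≡matches h []       []       = refl
  allFin-lookup≡matches h (x ∷ xs) (y ∷ ys) = cong ((h x == y) ∧_) (allFin-lookup≡matches h xs ys)

  every-collides≡matches : ∀ {n m j} (h : Fin n → Fin m) v w (t : Vec (Fin n) j) →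
                           (h v == w) ∧ every (λ u → h u == h v) t ≡ (h v == w) ∧ matches h t (replicate j w)
  every-collides≡matches h v w t with h v == w in hv==w
  ... | false = refl
  ... | true  rewrite ==-sound hv==w = every≡matches t
    where
      every≡matches : ∀ {j} (t : Vec _ j) → every (λ u → h u == w) t ≡ matches h t (replicate j w)
      every≡matches []      = refl
      every≡matches (u ∷ t) = cong ((h u == w) ∧_) (every≡matches t)

  count-marginal : ∀ {N m} .{{_ : NonZero m}} j (g : Fin N → Fin m) (Q : Fin N → Bool) →
                   (∀ w → count (λ i → (g i == w) ∧ Q i) * m ^ suc j ≡ N) → count Q * m ^ j ≡ N
  count-marginal {N} {m} j g Q uniform = *-cancelˡ-≡ (count Q * m ^ j) N m (begin
    m * (count Q * m ^ j)                               ≡⟨ x∙yz≈y∙xz m (count Q) (m ^ j) ⟩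
    count Q * m ^ suc j                                 ≡⟨ cong (_* m ^ suc j) (count-by-value g Q) ⟩
    (∑[ w < m ] count (λ i → (g i == w) ∧ Q i)) * m ^ suc j
                                                        ≡⟨ *-distribʳ-sum (m ^ suc j) (λ w → count (λ i → (g i == w) ∧ Q i)) ⟩
    ∑[ w < m ] (count (λ i → (g i == w) ∧ Q i) * m ^ suc j) ≡⟨ sum-cong-≗ uniform ⟩
    ∑[ w < m ] N                                        ≡⟨ sum-const m N ⟩
    m * N                                               ∎)
    where open ≡-Reasoning

  module _ {n m K c} .{{_ : NonZero m}} (H : Fin (suc K) → Fin n → Fin m)
           (H-independent : CWiseIndependent c H) (c≤n : c ≤ n) where

    Uniform : ℕ → Set
    Uniform j = (xs : Vec (Fin n) j) → distinct xs ≡ true → (ys : Vec (Fin m) j) →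
                count (λ i → matches (H i) xs ys) * m ^ j ≡ suc K

    uniform-c : Uniform c
    uniform-c xs dist ys =
      trans (cong (_* m ^ c) (count-cong (λ i → sym (allFin-lookup≡matches (H i) xs ys))))
            (H-independent (lookup xs) (distinct⇒injective xs dist) (lookup ys))

    uniform-pred : ∀ j → j < n → Uniform (suc j) → Uniform j
    uniform-pred j j<n uniform xs dist ys with fresh-exists j<n xs
    ... | p , p∉xs = count-marginal j (λ i → H i p) (λ i → matches (H i) xs ys)
                       (λ w → uniform (p ∷ xs) (trans (cong (_∧ distinct xs) p∉xs) dist) (w ∷ ys))

    uniform-gap : ∀ k {j} → j + k ≡ c → Uniform j
    uniform-gap zero    {j} j+0≡c = subst Uniform (sym (trans (sym (+-identityʳ j)) j+0≡c)) uniform-c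
    uniform-gap (suc k) {j} j+k+1≡c =
      uniform-pred j (<-≤-trans (m<m+n j (s≤s z≤n)) (≤-trans (≤-reflexive j+k+1≡c) c≤n))
                   (uniform-gap k (trans (sym (+-suc j k)) j+k+1≡c))

    uniform : ∀ j → j ≤ c → Uniform j
    uniform j j≤c = uniform-gap (c ∸ j) (m+[n∸m]≡n j≤c)

    count-collisions : ∀ v {j} (t : Vec (Fin n) j) → distinct (v ∷ t) ≡ true → suc j ≤ c →
                       count (λ i → every (λ u → H i u == H i v) t) * m ^ j ≡ suc K
    count-collisions v {j} t dist j<c = count-marginal j (λ i → H i v) (λ i → every (λ u → H i u == H i v) t)
      (λ w → trans (cong (_* m ^ suc j) (count-cong (λ i → every-collides≡matches (H i) v w t)))
                   (uniform (suc j) j<c (v ∷ t) dist (w ∷ replicate j w)))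

module FactorialMoments where

  open Counting
  open DistinctTuples
  open Independence
  open import Data.Nat using (ℕ; suc; _*_; _^_; _≤_; NonZero)
  open import Data.Nat.Properties using (*-comm; *-assoc)
  open import Data.Nat.Combinatorics.Base using (_P′_)
  open import Data.Bool using (Bool; true; false; _∧_)
  open import Data.Bool.Properties using (∧-assoc)
  open import Data.Fin using (Fin)
  open import Data.Vec using (Vec; []; _∷_)
  open import Data.Product using (_,_)
  open import Relation.Binary.PropositionalEquality

  neighbours-fresh : ∀ {n j} (G : Graph n) v (t : Vec (Fin n) j) → every (adj G v) t ≡ true → fresh v t ≡ true
  neighbours-fresh G v []      _   = refl
  neighbours-fresh G v (u ∷ t) adj-all with ∧-true⁻ (adj G v u) (every (adj G v) t) adj-all
  ... | v~u , rest with v == u in v==u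
  ...   | false = neighbours-fresh G v t rest
  ...   | true with () ← trans (sym v~u) (trans (cong (adj G v) (sym (==-sound v==u))) (irrefl G v))

  factorial-moment : ∀ {n m K c} .{{_ : NonZero m}} (H : Fin (suc K) → Fin n → Fin m) →
                     CWiseIndependent c H → c ≤ n → (G : Graph n) (v : Fin n) → ∀ j → suc j ≤ c →
                     (∑[ i < suc K ] (degree' G (H i) v P′ j)) * m ^ j ≡ suc K * (degree G v P′ j)
  factorial-moment {n} {m} {K} H H-independent c≤n G v j j<c = begin
    (∑[ i < suc K ] (degree' G (H i) v P′ j)) * m ^ j
      ≡⟨ cong (_* m ^ j) (sum-cong-≗ (λ i → sym (∑ⱽ-distinct-every (λ u → adj G v u ∧ collides i u) j))) ⟩
    (∑[ i < suc K ] ∑ⱽ j (λ t → 𝟙 (distinct t ∧ every (λ u → adj G v u ∧ collides i u) t))) * m ^ j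
      ≡⟨ cong (_* m ^ j) (∑-∑ⱽ-comm j (λ i t → 𝟙 (distinct t ∧ every (λ u → adj G v u ∧ collides i u) t))) ⟩
    ∑ⱽ j (λ t → ∑[ i < suc K ] 𝟙 (distinct t ∧ every (λ u → adj G v u ∧ collides i u) t)) * m ^ j
      ≡⟨ cong (_* m ^ j) (∑ⱽ-cong j split) ⟩
    ∑ⱽ j (λ t → neighbourTuple t * count (λ i → every (collides i) t)) * m ^ j
      ≡⟨ ∑ⱽ-distribʳ j (λ t → neighbourTuple t * count (λ i → every (collides i) t)) (m ^ j) ⟨
    ∑ⱽ j (λ t → neighbourTuple t * count (λ i → every (collides i) t) * m ^ j)
      ≡⟨ ∑ⱽ-cong j collisions ⟩
    ∑ⱽ j (λ t → neighbourTuple t * suc K)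
      ≡⟨ ∑ⱽ-distribʳ j neighbourTuple (suc K) ⟩
    ∑ⱽ j neighbourTuple * suc K
      ≡⟨ cong (_* suc K) (∑ⱽ-distinct-every (adj G v) j) ⟩
    (degree G v P′ j) * suc K
      ≡⟨ *-comm (degree G v P′ j) (suc K) ⟩
    suc K * (degree G v P′ j) ∎
    where
      open ≡-Reasoning
      collides : Fin (suc K) → Fin n → Bool
      collides i u = H i u == H i v
      neighbourTuple : Vec (Fin n) j → ℕ
      neighbourTuple t = 𝟙 (distinct t ∧ every (adj G v) t)
      split : ∀ t → ∑[ i < suc K ] 𝟙 (distinct t ∧ every (λ u → adj G v u ∧ collides i u) t)
                    ≡ neighbourTuple t * count (λ i → every (collides i) t)
      split t = begin
        ∑[ i < suc K ] 𝟙 (distinct t ∧ every (λ u → adj G v u ∧ collides i u) t)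
          ≡⟨ sum-cong-≗ (λ i → cong (λ b → 𝟙 (distinct t ∧ b)) (every-∧ (adj G v) (collides i) t)) ⟩
        ∑[ i < suc K ] 𝟙 (distinct t ∧ (every (adj G v) t ∧ every (collides i) t))
          ≡⟨ sum-cong-≗ (λ i → trans (cong 𝟙 (sym (∧-assoc (distinct t) (every (adj G v) t) (every (collides i) t))))
                                      (𝟙-∧ (distinct t ∧ every (adj G v) t) (every (collides i) t))) ⟩
        ∑[ i < suc K ] (neighbourTuple t * 𝟙 (every (collides i) t))
          ≡⟨ *-distribˡ-sum (neighbourTuple t) (λ i → 𝟙 (every (collides i) t)) ⟨
        neighbourTuple t * ∑[ i < suc K ] 𝟙 (every (collides i) t)
          ≡⟨ cong (neighbourTuple t *_) (count≡sum𝟙 (λ i → every (collides i) t)) ⟨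
        neighbourTuple t * count (λ i → every (collides i) t) ∎
      collisions : ∀ t → neighbourTuple t * count (λ i → every (collides i) t) * m ^ j ≡ neighbourTuple t * suc K
      collisions t with distinct t in dist | every (adj G v) t in adj-all
      ... | false | _     = refl
      ... | true  | false = refl
      ... | true  | true  = trans (*-assoc 1 (count (λ i → every (collides i) t)) (m ^ j)) (cong (1 *_)
        (count-collisions H H-independent c≤n v t (cong₂ _∧_ (neighbours-fresh G v t adj-all) dist) j<c))

module FallingFactorial where

  open import Data.Nat as ℕ using (ℕ; zero; suc; _∸_; _<_; s≤s)
  open import Data.Nat.Properties as ℕ using (m≤n⇒m<n∨m≡n; n∸n≡0; _≤?_; ≰⇒>; <⇒≤)
  open import Data.Nat.Combinatorics.Base using (_P′_)
  open import Data.Integer using (ℤ; +_; _+_; _*_; _-_; 0ℤ; 1ℤ)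
  open import Data.Integer.Properties using (pos-*; m-n≡m⊖n; ⊖-≥; *-zeroˡ; *-comm)
  open import Data.Integer.Tactic.RingSolver using (solve-∀)
  open import Data.Sum using (inj₁; inj₂)
  open import Relation.Nullary using (yes; no)
  open import Relation.Binary.PropositionalEquality

  falling : ℤ → ℕ → ℤ
  falling x zero    = 1ℤ
  falling x (suc j) = falling x j * (x - + j)

  falling-pascal : ∀ x j → falling (1ℤ + x) (suc j) ≡ falling x (suc j) + + suc j * falling x j
  falling-pascal x zero    = identity x
    where identity : ∀ x → 1ℤ * (1ℤ + x - 0ℤ) ≡ 1ℤ * (x - 0ℤ) + 1ℤ * 1ℤ
          identity = solve-∀
  falling-pascal x (suc j) = trans (cong (_* (1ℤ + x - + suc j)) (falling-pascal x j)) (identity x (+ j) (falling x j))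
    where identity : ∀ x j f → (f * (x - j) + (1ℤ + j) * f) * (1ℤ + x - (1ℤ + j))
                              ≡ f * (x - j) * (x - (1ℤ + j)) + (1ℤ + (1ℤ + j)) * (f * (x - j))
          identity = solve-∀

  P′-vanishes : ∀ x j → x < j → x P′ j ≡ 0
  P′-vanishes x (suc j) (s≤s x≤j) with m≤n⇒m<n∨m≡n x≤j
  ... | inj₁ x<j  = trans (cong ((x ∸ j) ℕ.*_) (P′-vanishes x j x<j)) (ℕ.*-zeroʳ (x ∸ j))
  ... | inj₂ refl = cong (ℕ._* (x P′ x)) (n∸n≡0 x)

  P′≡falling : ∀ x j → + (x P′ j) ≡ falling (+ x) j
  P′≡falling x zero = refl
  P′≡falling x (suc j) with j ≤? x
  ... | yes j≤x = begin
    + ((x ∸ j) ℕ.* (x P′ j))         ≡⟨ pos-* (x ∸ j) (x P′ j) ⟩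
    + (x ∸ j) * + (x P′ j)           ≡⟨ cong₂ _*_ (sym (trans (m-n≡m⊖n x j) (⊖-≥ j≤x))) (P′≡falling x j) ⟩
    (+ x - + j) * falling (+ x) j    ≡⟨ *-comm (+ x - + j) (falling (+ x) j) ⟩
    falling (+ x) (suc j)            ∎
    where open ≡-Reasoning
  ... | no  j≰x = begin
    + (x P′ suc j)                   ≡⟨ cong +_ (P′-vanishes x (suc j) (s≤s (<⇒≤ (≰⇒> j≰x)))) ⟩
    0ℤ                               ≡⟨ *-zeroˡ (+ x - + j) ⟨
    0ℤ * (+ x - + j)                 ≡⟨ cong (λ f → f * (+ x - + j)) (trans (cong +_ (sym (P′-vanishes x j (≰⇒> j≰x)))) (P′≡falling x j)) ⟩
    falling (+ x) (suc j)            ∎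
    where open ≡-Reasoning

module FallingBasis where

  open FallingFactorial
  open import Data.Nat as ℕ using (ℕ; zero; suc; _≤_; _<_)
  open import Data.Nat.Properties as ℕ using (+-suc; ≤-trans; ≤-reflexive; m≤m+n)
  open import Data.Integer using (ℤ; +_; _+_; _*_; _-_; _^_; 0ℤ; 1ℤ)
  open import Data.Integer.Properties using (*-zeroˡ; *-zeroʳ)
  open import Data.Integer.Tactic.RingSolver using (solve-∀)
  open import Data.List using (List; []; _∷_; length)
  open import Data.Fin using (Fin; zero; suc)
  open import Relation.Binary.PropositionalEquality
  open import Data.Integer.Properties using (+-*-semiring)
  open import Algebra.Properties.Semiring.Sum +-*-semiring using (sum-syntax)

  record Linear (S : (ℕ → ℤ) → ℤ) : Set where
    field
      cong-≗ : ∀ {f g} → (∀ x → f x ≡ g x) → S f ≡ S g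
      additive : ∀ f g → S (λ x → f x + g x) ≡ S f + S g
      homogeneous : ∀ a f → S (λ x → a * f x) ≡ a * S f

    zero-map : S (λ _ → 0ℤ) ≡ 0ℤ
    zero-map = trans (cong-≗ (λ _ → sym (*-zeroˡ 0ℤ))) (trans (homogeneous 0ℤ (λ _ → 0ℤ)) (*-zeroˡ (S (λ _ → 0ℤ))))

    preserves-sum : ∀ n (f : Fin n → ℕ → ℤ) → S (λ x → ∑[ k < n ] f k x) ≡ ∑[ k < n ] S (f k)
    preserves-sum zero    f = zero-map
    preserves-sum (suc n) f = trans (additive (f zero) (λ x → ∑[ k < n ] f (suc k) x))
                                    (cong (λ s → S (f zero) + s) (preserves-sum n (λ k → f (suc k))))

  module _ (m : ℕ) where

    basis : ℕ → ℕ → ℤ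
    basis j x = falling (+ x) j * (+ m) ^ j

    eval : ℕ → List ℤ → ℕ → ℤ
    eval j []       x = 0ℤ
    eval j (c ∷ cs) x = c * basis j x + eval (suc j) cs x

    centred : ℕ → ℕ → ℤ
    centred d x = + m * + x - + d

    -- Coefficients of `centred d` times a polynomial, from (m x − d)·basis j x = basis (j+1) x + (j m − d)·basis j x.
    mulCentred : ℕ → ℕ → ℤ → List ℤ → List ℤ
    mulCentred d j c₋ []       = c₋ ∷ []
    mulCentred d j c₋ (c ∷ cs) = ((+ j * + m - + d) * c + c₋) ∷ mulCentred d (suc j) c cs

    eval-mulCentred : ∀ d j c₋ cs x → eval j (mulCentred d j c₋ cs) x ≡ c₋ * basis j x + centred d x * eval j cs x
    eval-mulCentred d j c₋ []       x = identity c₋ (basis j x) (centred d x)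
      where identity : ∀ c b z → c * b + 0ℤ ≡ c * b + z * 0ℤ
            identity = solve-∀
    eval-mulCentred d j c₋ (c ∷ cs) x =
      trans (cong (λ e → ((+ j * + m - + d) * c + c₋) * basis j x + e) (eval-mulCentred d (suc j) c cs x))
            (identity (+ j) (+ m) (+ d) (+ x) c c₋ (falling (+ x) j) ((+ m) ^ j) (eval (suc j) cs x))
      where identity : ∀ j m d x c c₋ f mʲ e →
                         ((j * m - d) * c + c₋) * (f * mʲ) + (c * ((f * (x - j)) * (m * mʲ)) + (m * x - d) * e)
                         ≡ c₋ * (f * mʲ) + (m * x - d) * (c * (f * mʲ) + e)
            identity = solve-∀

    centredPower : ℕ → ℕ → List ℤ
    centredPower d zero    = 1ℤ ∷ []
    centredPower d (suc p) = mulCentred d 0 0ℤ (centredPower d p)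

    eval-centredPower : ∀ d p x → eval 0 (centredPower d p) x ≡ centred d x ^ p
    eval-centredPower d zero    x = refl
    eval-centredPower d (suc p) x =
      trans (eval-mulCentred d 0 0ℤ (centredPower d p) x)
            (trans (cong (λ e → 0ℤ * basis 0 x + centred d x * e) (eval-centredPower d p x))
                   (identity (basis 0 x) (centred d x) (centred d x ^ p)))
      where identity : ∀ b z w → 0ℤ * b + z * w ≡ z * w
            identity = solve-∀

    length-mulCentred : ∀ d j c₋ cs → length (mulCentred d j c₋ cs) ≡ suc (length cs)
    length-mulCentred d j c₋ []       = refl
    length-mulCentred d j c₋ (c ∷ cs) = cong suc (length-mulCentred d (suc j) c cs)

    length-centredPower : ∀ d p → length (centredPower d p) ≡ suc p
    length-centredPower d zero    = refl
    length-centredPower d (suc p) = trans (length-mulCentred d 0 0ℤ (centredPower d p)) (cong suc (length-centredPower d p))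

    module _ {S T : (ℕ → ℤ) → ℤ} (S-linear : Linear S) (T-linear : Linear T) (α β : ℤ) (B : ℕ)
             (on-basis : ∀ j → j < B → β * S (basis j) ≡ α * T (basis j)) where

      private
        module S = Linear S-linear
        module T = Linear T-linear

      proportional-on-span : ∀ j cs → j ℕ.+ length cs ≤ B → β * S (eval j cs) ≡ α * T (eval j cs)
      proportional-on-span j [] _ = trans (cong (β *_) S.zero-map) (trans (*-zeroʳ β) (sym (trans (cong (α *_) T.zero-map) (*-zeroʳ α))))
      proportional-on-span j (c ∷ cs) j+|cs|<B = begin
        β * S (eval j (c ∷ cs))                     ≡⟨ cong (β *_) (expand S-linear) ⟩
        β * (c * S (basis j) + S (eval (suc j) cs)) ≡⟨ distribute β c (S (basis j)) (S (eval (suc j) cs)) ⟩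
        c * (β * S (basis j)) + β * S (eval (suc j) cs)
          ≡⟨ cong₂ (λ u v → c * u + v) (on-basis j j<B) (proportional-on-span (suc j) cs rest<B) ⟩
        c * (α * T (basis j)) + α * T (eval (suc j) cs) ≡⟨ distribute α c (T (basis j)) (T (eval (suc j) cs)) ⟨
        α * (c * T (basis j) + T (eval (suc j) cs)) ≡⟨ cong (α *_) (expand T-linear) ⟨
        α * T (eval j (c ∷ cs))                     ∎
        where
          open ≡-Reasoning
          expand : ∀ {U} → Linear U → U (eval j (c ∷ cs)) ≡ c * U (basis j) + U (eval (suc j) cs)
          expand U-linear = trans (U.additive (λ x → c * basis j x) (eval (suc j) cs))
                                  (cong (_+ _) (U.homogeneous c (basis j)))
            where module U = Linear U-linear
          distribute : ∀ k c u v → k * (c * u + v) ≡ c * (k * u) + k * v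
          distribute = solve-∀
          rest<B : suc j ℕ.+ length cs ≤ B
          rest<B = ≤-trans (≤-reflexive (sym (+-suc j (length cs)))) j+|cs|<B
          j<B : j < B
          j<B = ≤-trans (m≤m+n (suc j) (length cs)) rest<B

      proportional-on-centredPower : ∀ d p → suc p ≤ B →
                                     β * S (λ x → centred d x ^ p) ≡ α * T (λ x → centred d x ^ p)
      proportional-on-centredPower d p p<B =
        trans (cong (β *_) (S.cong-≗ (λ x → sym (eval-centredPower d p x))))
              (trans (proportional-on-span 0 (centredPower d p) (≤-trans (≤-reflexive (length-centredPower d p)) p<B))
                     (cong (α *_) (T.cong-≗ (eval-centredPower d p))))

module Integers where

  open import Data.Nat as ℕ using (ℕ; zero; suc; _≤_; z≤n)
  open import Data.Nat.Properties as ℕ using (+-monoʳ-≤; ≤-trans)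
  open import Data.Integer using (ℤ; +_; -[1+_]; _+_; _*_; _^_; ∣_∣)
  open import Data.Integer.Properties using (+-*-semiring; pos-+; pos-*; abs-*; ∣i+j∣≤∣i∣+∣j∣; ^-*-assoc)
  open import Data.Fin using (Fin; zero; suc)
  open import Relation.Binary.PropositionalEquality
  open import Algebra.Properties.Semiring.Sum +-*-semiring using (sum; sum-syntax)
  private module ℕΣ = Counting

  pos-sum : ∀ {n} (f : Fin n → ℕ) → + (ℕΣ.sum f) ≡ ∑[ k < n ] (+ f k)
  pos-sum {zero}  f = refl
  pos-sum {suc n} f = trans (pos-+ (f zero) _) (cong (λ s → + f zero + s) (pos-sum (λ k → f (suc k))))

  ∣sum∣≤sum∣∣ : ∀ {n} (f : Fin n → ℤ) → ∣ sum f ∣ ≤ ℕΣ.sum (λ k → ∣ f k ∣)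
  ∣sum∣≤sum∣∣ {zero}  f = z≤n
  ∣sum∣≤sum∣∣ {suc n} f = ≤-trans (∣i+j∣≤∣i∣+∣j∣ (f zero) _) (+-monoʳ-≤ ∣ f zero ∣ (∣sum∣≤sum∣∣ (λ k → f (suc k))))

  pos-^ : ∀ a n → + (a ℕ.^ n) ≡ (+ a) ^ n
  pos-^ a zero    = refl
  pos-^ a (suc n) = trans (pos-* a (a ℕ.^ n)) (cong (+ a *_) (pos-^ a n))

  abs-^ : ∀ x n → ∣ x ^ n ∣ ≡ ∣ x ∣ ℕ.^ n
  abs-^ x zero    = refl
  abs-^ x (suc n) = trans (abs-* x (x ^ n)) (cong (∣ x ∣ ℕ.*_) (abs-^ x n))

  square≡∣∣² : ∀ x → x ^ 2 ≡ + (∣ x ∣ ℕ.^ 2)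
  square≡∣∣² (+ n)    = sym (pos-^ n 2)
  square≡∣∣² -[1+ n ] = refl

  even-power≡∣∣ : ∀ x k → x ^ (2 ℕ.* k) ≡ + (∣ x ∣ ℕ.^ (2 ℕ.* k))
  even-power≡∣∣ x k = begin
    x ^ (2 ℕ.* k)              ≡⟨ ^-*-assoc x 2 k ⟨
    (x ^ 2) ^ k                ≡⟨ cong (_^ k) (square≡∣∣² x) ⟩
    (+ (∣ x ∣ ℕ.^ 2)) ^ k      ≡⟨ pos-^ (∣ x ∣ ℕ.^ 2) k ⟨
    + ((∣ x ∣ ℕ.^ 2) ℕ.^ k)    ≡⟨ cong +_ (ℕ.^-*-assoc ∣ x ∣ 2 k) ⟩
    + (∣ x ∣ ℕ.^ (2 ℕ.* k))    ∎
    where open ≡-Reasoning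

module BinomialTheorem where

  open import Data.Nat as ℕ using (ℕ; zero; suc; _∸_; _≤_)
  open import Data.Nat.Properties using (m≤m+n; module ≤-Reasoning)
  open import Data.Nat.Combinatorics using (_C_)
  open import Data.Integer using (+_; _+_; _*_; _^_; 1ℤ)
  open import Data.Fin using (inject₁; fromℕ)
  open import Data.Fin.Properties using (toℕ-inject₁)
  open import Data.Integer.Properties
    using (+-*-commutativeSemiring; +-*-semiring; *-zeroˡ; *-identityʳ; ^-zeroˡ; +-injective)
  open import Data.Integer.Tactic.RingSolver using (solve-∀)
  open Integers using (pos-sum; pos-^)
  private module ℕΣ = Counting
  open import Data.Fin using (Fin; toℕ)
  open import Relation.Binary.PropositionalEquality
  open import Algebra.Properties.Semiring.Sum +-*-semiring using (sum-syntax; sum-cong-≗)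
  import Algebra.Properties.CommutativeSemiring.Binomial +-*-commutativeSemiring as Binomial
  import Algebra.Properties.Semiring.Exp +-*-semiring as Exp
  import Algebra.Properties.Semiring.Mult +-*-semiring as Mult

  private
    ^≡^ : ∀ x n → x Exp.^ n ≡ x ^ n
    ^≡^ x zero    = refl
    ^≡^ x (suc n) = cong (x *_) (^≡^ x n)

    ×≡* : ∀ c x → c Mult.× x ≡ + c * x
    ×≡* zero    x = sym (*-zeroˡ x)
    ×≡* (suc c) x = trans (cong (λ s → x + s) (×≡* c x)) (identity x (+ c))
      where identity : ∀ x c → x + c * x ≡ (1ℤ + c) * x
            identity = solve-∀

  binomial-theorem : ∀ p x y → (x + y) ^ p ≡ ∑[ k < suc p ] (+ (p C toℕ k) * (x ^ toℕ k * y ^ (p ∸ toℕ k)))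
  binomial-theorem p x y = begin
    (x + y) ^ p                       ≡⟨ ^≡^ (x + y) p ⟨
    (x + y) Exp.^ p                   ≡⟨ Binomial.theorem p x y ⟩
    Binomial.binomialExpansion x y p  ≡⟨ sum-cong-≗ term ⟩
    ∑[ k < suc p ] (+ (p C toℕ k) * (x ^ toℕ k * y ^ (p ∸ toℕ k))) ∎
    where
      open ≡-Reasoning
      term : ∀ k → Binomial.binomialTerm x y p k ≡ + (p C toℕ k) * (x ^ toℕ k * y ^ (p ∸ toℕ k))
      term k = trans (×≡* (p C toℕ k) _) (cong (+ (p C toℕ k) *_) (cong₂ _*_ (^≡^ x (toℕ k)) (^≡^ y (p ∸ toℕ k))))

  binomial-sum : ∀ p → ℕΣ.sum {suc p} (λ k → p C toℕ k) ≡ 2 ℕ.^ p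
  binomial-sum p = +-injective (begin
    + (ℕΣ.sum {suc p} (λ k → p C toℕ k))                       ≡⟨ pos-sum {suc p} (λ k → p C toℕ k) ⟩
    ∑[ k < suc p ] (+ (p C toℕ k))                             ≡⟨ sum-cong-≗ (λ k → sym (ones k)) ⟩
    ∑[ k < suc p ] (+ (p C toℕ k) * (1ℤ ^ toℕ k * 1ℤ ^ (p ∸ toℕ k))) ≡⟨ binomial-theorem p 1ℤ 1ℤ ⟨
    (+ 2) ^ p                                                   ≡⟨ pos-^ 2 p ⟨
    + (2 ℕ.^ p)                                                 ∎)
    where
      open ≡-Reasoning
      ones : ∀ (k : Fin (suc p)) → + (p C toℕ k) * (1ℤ ^ toℕ k * 1ℤ ^ (p ∸ toℕ k)) ≡ + (p C toℕ k)
      ones k = trans (cong (+ (p C toℕ k) *_) (cong₂ _*_ (^-zeroˡ (toℕ k)) (^-zeroˡ (p ∸ toℕ k)))) (*-identityʳ _)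

  binomial-sum-init≤ : ∀ p → ℕΣ.sum {p} (λ k → p C toℕ k) ≤ 2 ℕ.^ p
  binomial-sum-init≤ p = begin
    ℕΣ.sum {p} (λ k → p C toℕ k)                       ≡⟨ ℕΣ.sum-cong-≗ {p} (λ k → cong (p C_) (toℕ-inject₁ k)) ⟨
    ℕΣ.sum {p} (λ k → p C toℕ (inject₁ k))             ≤⟨ m≤m+n _ (p C toℕ (fromℕ p)) ⟩
    ℕΣ.sum {p} (λ k → p C toℕ (inject₁ k)) ℕ.+ p C toℕ (fromℕ p) ≡⟨ ℕΣ.sum-init-last {p} (λ k → p C toℕ k) ⟨
    ℕΣ.sum {suc p} (λ k → p C toℕ k)                   ≡⟨ binomial-sum p ⟩
    2 ℕ.^ p                                            ∎
    where open ≤-Reasoning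

module MomentConstant where

  open import Data.Nat using (ℕ; zero; suc; _*_; _^_; _≤_; s≤s; z≤n)
  open import Data.Nat.Properties using (≤-refl; ≤-trans; n≤1+n; m≤n*m; *-mono-≤; ^-monoʳ-≤; m≤n⇒m<n∨m≡n)
  open import Data.Sum using (inj₁; inj₂)
  open import Relation.Binary.PropositionalEquality using (refl)

  -- κ (q+2) = 2^(q+3)·κ q pays for the binomial sum 2^(q+2) and the factor 2 in the bound on `weight`.
  κ : ℕ → ℕ
  κ zero          = 1
  κ (suc zero)    = 1
  κ (suc (suc q)) = 2 ^ suc (suc (suc q)) * κ q

  κ-step : ∀ k → κ k ≤ κ (suc k)
  κ-step zero          = ≤-refl
  κ-step (suc zero)    = m≤n*m 1 (2 ^ 3)
  κ-step (suc (suc q)) = *-mono-≤ (^-monoʳ-≤ 2 (n≤1+n (suc (suc (suc q))))) (κ-step q)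

  κ-mono : ∀ {k q} → k ≤ q → κ k ≤ κ q
  κ-mono {q = zero}  z≤n  = ≤-refl
  κ-mono {q = suc q} k≤1+q with m≤n⇒m<n∨m≡n k≤1+q
  ... | inj₁ (s≤s k≤q) = ≤-trans (κ-mono k≤q) (κ-step q)
  ... | inj₂ refl      = ≤-refl

module BinomialMoments (m : ℕ) where

  open FallingFactorial
  open FallingBasis using (Linear)
  open FallingBasis.Linear
  open BinomialTheorem
  open MomentConstant
  open import Data.Nat as ℕ using (ℕ; zero; suc; _∸_)
  open import Data.Nat.Combinatorics using (_C_)
  open import Data.Integer using (ℤ; +_; _+_; _*_; _-_; -_; _^_; 0ℤ; 1ℤ; ∣_∣)
  open import Data.Nat using (_≤_; _<_; z≤n; s≤s; NonZero)
  import Data.Nat.Properties as ℕ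
  open import Data.Nat.Properties using (n∸n≡0; ≤-refl; ≤-reflexive; ≤-trans; m≤n+m; n≤1+n; *-commutativeSemigroup)
  open import Data.Nat.Combinatorics using (nCn≡1)
  open import Data.Sum using (inj₁; inj₂)
  open import Algebra.Properties.CommutativeSemigroup *-commutativeSemigroup using (x∙yz≈y∙xz)
  open import Data.Integer.Properties using (+-*-semiring; *-zeroˡ; *-identityˡ; *-assoc; abs-*; ∣i+j∣≤∣i∣+∣j∣)
  open import Data.Integer.Tactic.RingSolver using (solve-∀)
  import Data.Nat.Tactic.RingSolver as ℕSolver
  open Integers using (abs-^; ∣sum∣≤sum∣∣)
  open import Data.Fin using (Fin; toℕ; inject₁; fromℕ)
  open import Data.Fin.Properties using (toℕ-inject₁; toℕ-fromℕ; toℕ<n)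
  open import Relation.Binary.PropositionalEquality
  open import Algebra.Properties.Semiring.Sum +-*-semiring
    using (sum-syntax; sum-cong-≗; ∑-distrib-+; *-distribˡ-sum; sum-init-last)
  private module ℕΣ = Counting

  basis : ℕ → ℕ → ℤ
  basis = FallingBasis.basis m

  centred : ℕ → ℕ → ℤ
  centred = FallingBasis.centred m

  -- Bin d g = Σₓ C(d,x)·(m−1)^(d−x)·g x, that is m^d times the mean of g over Binomial(d, 1/m).
  Bin : ℕ → (ℕ → ℤ) → ℤ
  Bin zero    g = g 0
  Bin (suc d) g = Bin d (λ x → (+ m - 1ℤ) * g x + g (suc x))

  Bin-linear : ∀ d → Linear (Bin d)
  Bin-linear zero    = record { cong-≗ = λ f≗g → f≗g 0 ; additive = λ _ _ → refl ; homogeneous = λ _ _ → refl }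
  Bin-linear (suc d) = record
    { cong-≗      = λ f≗g → cong-≗ (Bin-linear d) (λ x → cong₂ (λ u v → (+ m - 1ℤ) * u + v) (f≗g x) (f≗g (suc x)))
    ; additive    = λ f g → trans (cong-≗ (Bin-linear d) (λ x → regroup (+ m - 1ℤ) (f x) (g x) (f (suc x)) (g (suc x))))
                                  (additive (Bin-linear d) _ _)
    ; homogeneous = λ a f → trans (cong-≗ (Bin-linear d) (λ x → factor (+ m - 1ℤ) a (f x) (f (suc x))))
                                  (homogeneous (Bin-linear d) a _)
    }
    where
      regroup : ∀ w a b c e → w * (a + b) + (c + e) ≡ (w * a + c) + (w * b + e)
      regroup = solve-∀
      factor : ∀ w a b c → w * (a * b) + a * c ≡ a * (w * b + c)
      factor = solve-∀

  basis-shift : ∀ j x → (+ m - 1ℤ) * basis (suc j) x + basis (suc j) (suc x)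
                        ≡ + m * basis (suc j) x + (+ suc j * + m) * basis j x
  basis-shift j x = begin
    (+ m - 1ℤ) * basis (suc j) x + falling (1ℤ + + x) (suc j) * (+ m) ^ suc j
      ≡⟨ cong (λ f → (+ m - 1ℤ) * basis (suc j) x + f * (+ m) ^ suc j) (falling-pascal (+ x) j) ⟩
    (+ m - 1ℤ) * basis (suc j) x + (falling (+ x) (suc j) + + suc j * falling (+ x) j) * (+ m) ^ suc j
      ≡⟨ identity (+ m) (falling (+ x) (suc j)) (falling (+ x) j) (+ suc j) ((+ m) ^ j) ⟩
    + m * basis (suc j) x + (+ suc j * + m) * basis j x ∎
    where
      open ≡-Reasoning
      identity : ∀ m f₁ f₀ s mʲ → (m - 1ℤ) * (f₁ * (m * mʲ)) + (f₁ + s * f₀) * (m * mʲ)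
                                  ≡ m * (f₁ * (m * mʲ)) + (s * m) * (f₀ * mʲ)
      identity = solve-∀

  Bin-basis : ∀ d j → Bin d (basis j) ≡ (+ m) ^ d * falling (+ d) j
  Bin-basis zero    zero    = refl
  Bin-basis zero    (suc j) = begin
    falling (+ 0) (suc j) * (+ m) ^ suc j ≡⟨ cong (_* (+ m) ^ suc j) falling-0 ⟩
    0ℤ * (+ m) ^ suc j                    ≡⟨ *-zeroˡ ((+ m) ^ suc j) ⟩
    0ℤ                                    ≡⟨ falling-0 ⟨
    falling (+ 0) (suc j)                 ≡⟨ *-identityˡ (falling (+ 0) (suc j)) ⟨
    1ℤ * falling (+ 0) (suc j)            ∎
    where
      open ≡-Reasoning
      falling-0 : falling (+ 0) (suc j) ≡ 0ℤ
      falling-0 = trans (sym (P′≡falling 0 (suc j))) (cong +_ (P′-vanishes 0 (suc j) (ℕ.s≤s ℕ.z≤n)))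
  Bin-basis (suc d) zero    = begin
    Bin d (λ x → (+ m - 1ℤ) * basis 0 x + basis 0 (suc x)) ≡⟨ cong-≗ (Bin-linear d) (λ _ → identity (+ m)) ⟩
    Bin d (λ x → + m * basis 0 x)                          ≡⟨ homogeneous (Bin-linear d) (+ m) (basis 0) ⟩
    + m * Bin d (basis 0)                                  ≡⟨ cong (+ m *_) (Bin-basis d 0) ⟩
    + m * ((+ m) ^ d * 1ℤ)                                 ≡⟨ *-assoc (+ m) ((+ m) ^ d) 1ℤ ⟨
    (+ m) ^ suc d * 1ℤ                                     ∎
    where
      open ≡-Reasoning
      identity : ∀ m → (m - 1ℤ) * (1ℤ * 1ℤ) + 1ℤ * 1ℤ ≡ m * (1ℤ * 1ℤ)
      identity = solve-∀
  Bin-basis (suc d) (suc j) = begin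
    Bin d (λ x → (+ m - 1ℤ) * basis (suc j) x + basis (suc j) (suc x))
      ≡⟨ cong-≗ (Bin-linear d) (basis-shift j) ⟩
    Bin d (λ x → + m * basis (suc j) x + (+ suc j * + m) * basis j x)
      ≡⟨ additive (Bin-linear d) (λ x → + m * basis (suc j) x) (λ x → (+ suc j * + m) * basis j x) ⟩
    Bin d (λ x → + m * basis (suc j) x) + Bin d (λ x → (+ suc j * + m) * basis j x)
      ≡⟨ cong₂ _+_ (homogeneous (Bin-linear d) (+ m) (basis (suc j))) (homogeneous (Bin-linear d) (+ suc j * + m) (basis j)) ⟩
    + m * Bin d (basis (suc j)) + (+ suc j * + m) * Bin d (basis j)
      ≡⟨ cong₂ (λ u v → + m * u + (+ suc j * + m) * v) (Bin-basis d (suc j)) (Bin-basis d j) ⟩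
    + m * ((+ m) ^ d * falling (+ d) (suc j)) + (+ suc j * + m) * ((+ m) ^ d * falling (+ d) j)
      ≡⟨ identity (+ m) ((+ m) ^ d) (falling (+ d) (suc j)) (falling (+ d) j) (+ suc j) ⟩
    (+ m) ^ suc d * (falling (+ d) (suc j) + + suc j * falling (+ d) j)
      ≡⟨ cong ((+ m) ^ suc d *_) (falling-pascal (+ d) j) ⟨
    (+ m) ^ suc d * falling (+ suc d) (suc j) ∎
    where
      open ≡-Reasoning
      identity : ∀ m mᵈ f₁ f₀ s → m * (mᵈ * f₁) + (s * m) * (mᵈ * f₀) ≡ (m * mᵈ) * (f₁ + s * f₀)
      identity = solve-∀

  moment : ℕ → ℕ → ℤ
  moment d p = Bin d (λ x → centred d x ^ p)

  -- m times the s-th moment of the one-trial increment, which is m − 1 with probability 1/m and −1 otherwise.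
  weight : ℕ → ℤ
  weight s = (+ m - 1ℤ) * (- 1ℤ) ^ s + (+ m - 1ℤ) ^ s

  term : ℕ → ℕ → ℕ → ℤ
  term d p k = + (p C k) * weight (p ∸ k) * moment d k

  shifted-power : ∀ p z → (+ m - 1ℤ) * (z + - 1ℤ) ^ p + (z + (+ m - 1ℤ)) ^ p
                          ≡ ∑[ k < suc p ] (+ (p C toℕ k) * weight (p ∸ toℕ k) * z ^ toℕ k)
  shifted-power p z = begin
    M₁ * (z + - 1ℤ) ^ p + (z + M₁) ^ p
      ≡⟨ cong₂ (λ u v → M₁ * u + v) (binomial-theorem p z (- 1ℤ)) (binomial-theorem p z M₁) ⟩
    M₁ * ∑[ k < suc p ] expansion (- 1ℤ) k + ∑[ k < suc p ] expansion M₁ k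
      ≡⟨ cong (_+ ∑[ k < suc p ] expansion M₁ k) (*-distribˡ-sum M₁ (expansion (- 1ℤ))) ⟩
    ∑[ k < suc p ] (M₁ * expansion (- 1ℤ) k) + ∑[ k < suc p ] expansion M₁ k
      ≡⟨ ∑-distrib-+ (λ k → M₁ * expansion (- 1ℤ) k) (expansion M₁) ⟨
    ∑[ k < suc p ] (M₁ * expansion (- 1ℤ) k + expansion M₁ k)
      ≡⟨ sum-cong-≗ (λ k → collect M₁ (c k) (z ^ toℕ k) ((- 1ℤ) ^ (p ∸ toℕ k)) (M₁ ^ (p ∸ toℕ k))) ⟩
    ∑[ k < suc p ] (c k * weight (p ∸ toℕ k) * z ^ toℕ k) ∎
    where
      open ≡-Reasoning
      M₁ : ℤ
      M₁ = + m - 1ℤ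
      c : Fin (suc p) → ℤ
      c k = + (p C toℕ k)
      expansion : ℤ → Fin (suc p) → ℤ
      expansion y k = c k * (z ^ toℕ k * y ^ (p ∸ toℕ k))
      collect : ∀ w c z s t → w * (c * (z * s)) + c * (z * t) ≡ c * (w * s + t) * z
      collect = solve-∀

  moment-suc : ∀ d p → moment (suc d) p ≡ ∑[ k < suc p ] term d p (toℕ k)
  moment-suc d p = begin
    Bin d (λ x → (+ m - 1ℤ) * centred (suc d) x ^ p + centred (suc d) (suc x) ^ p)
      ≡⟨ cong-≗ (Bin-linear d) (λ x → cong₂ (λ u v → (+ m - 1ℤ) * u ^ p + v ^ p) (centred-suc-d x) (centred-suc-suc x)) ⟩
    Bin d (λ x → (+ m - 1ℤ) * (centred d x + - 1ℤ) ^ p + (centred d x + (+ m - 1ℤ)) ^ p)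
      ≡⟨ cong-≗ (Bin-linear d) (λ x → shifted-power p (centred d x)) ⟩
    Bin d (λ x → ∑[ k < suc p ] (+ (p C toℕ k) * weight (p ∸ toℕ k) * centred d x ^ toℕ k))
      ≡⟨ preserves-sum (Bin-linear d) (suc p) (λ k x → + (p C toℕ k) * weight (p ∸ toℕ k) * centred d x ^ toℕ k) ⟩
    ∑[ k < suc p ] Bin d (λ x → + (p C toℕ k) * weight (p ∸ toℕ k) * centred d x ^ toℕ k)
      ≡⟨ sum-cong-≗ {suc p} (λ k → homogeneous (Bin-linear d) (+ (p C toℕ k) * weight (p ∸ toℕ k)) (λ x → centred d x ^ toℕ k)) ⟩
    ∑[ k < suc p ] term d p (toℕ k) ∎
    where
      open ≡-Reasoning
      centred-suc-d : ∀ x → centred (suc d) x ≡ centred d x + - 1ℤ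
      centred-suc-d x = identity (+ m * + x) (+ d)
        where identity : ∀ a d → a - (1ℤ + d) ≡ (a - d) + - 1ℤ
              identity = solve-∀
      centred-suc-suc : ∀ x → centred (suc d) (suc x) ≡ centred d x + (+ m - 1ℤ)
      centred-suc-suc x = identity (+ m) (+ x) (+ d)
        where identity : ∀ m x d → m * (1ℤ + x) - (1ℤ + d) ≡ (m * x - d) + (m - 1ℤ)
              identity = solve-∀

  weight-zero : weight 0 ≡ + m
  weight-zero = identity (+ m)
    where identity : ∀ m → (m - 1ℤ) * 1ℤ + 1ℤ ≡ m
          identity = solve-∀

  weight-one : weight 1 ≡ 0ℤ
  weight-one = identity (+ m - 1ℤ)
    where identity : ∀ w → w * (- 1ℤ * 1ℤ) + w * 1ℤ ≡ 0ℤ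
          identity = solve-∀

  term-last : ∀ d p → term d p p ≡ + m * moment d p
  term-last d p = begin
    + (p C p) * weight (p ∸ p) * moment d p ≡⟨ cong₂ (λ c s → + c * weight s * moment d p) (nCn≡1 p) (n∸n≡0 p) ⟩
    + 1 * weight 0 * moment d p             ≡⟨ cong (λ w → + 1 * w * moment d p) weight-zero ⟩
    + 1 * + m * moment d p                  ≡⟨ cong (_* moment d p) (*-identityˡ (+ m)) ⟩
    + m * moment d p                        ∎
    where open ≡-Reasoning

  moment-suc-split : ∀ d p → moment (suc d) p ≡ ∑[ k < p ] term d p (toℕ k) + + m * moment d p
  moment-suc-split d p = begin
    moment (suc d) p                                                  ≡⟨ moment-suc d p ⟩
    ∑[ k < suc p ] term d p (toℕ k)                                   ≡⟨ sum-init-last {p} (λ k → term d p (toℕ k)) ⟩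
    ∑[ k < p ] term d p (toℕ (inject₁ k)) + term d p (toℕ (fromℕ p))
      ≡⟨ cong₂ _+_ (sum-cong-≗ {p} (λ k → cong (term d p) (toℕ-inject₁ k))) (cong (term d p) (toℕ-fromℕ p)) ⟩
    ∑[ k < p ] term d p (toℕ k) + term d p p                          ≡⟨ cong (λ t → ∑[ k < p ] term d p (toℕ k) + t) (term-last d p) ⟩
    ∑[ k < p ] term d p (toℕ k) + + m * moment d p                    ∎
    where open ≡-Reasoning

  Λ : ℕ → ℕ → ℕ
  Λ d zero          = 1
  Λ d (suc zero)    = m
  Λ d (suc (suc k)) = m ℕ.* (d ℕ.+ m) ℕ.* Λ d k

  Λ-step : ∀ d k → m ℕ.* Λ d k ≤ Λ d (suc k)
  Λ-step d zero          = ≤-reflexive (ℕ.*-identityʳ m)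
  Λ-step d (suc zero)    = ≤-trans (ℕ.*-monoʳ-≤ m (m≤n+m m d)) (≤-reflexive (sym (ℕ.*-identityʳ _)))
  Λ-step d (suc (suc k)) = begin
    m ℕ.* (L ℕ.* Λ d k) ≡⟨ x∙yz≈y∙xz m L (Λ d k) ⟩
    L ℕ.* (m ℕ.* Λ d k) ≤⟨ ℕ.*-monoʳ-≤ L (Λ-step d k) ⟩
    L ℕ.* Λ d (suc k)   ∎
    where
      open ℕ.≤-Reasoning
      L : ℕ
      L = m ℕ.* (d ℕ.+ m)

  Λ-shift : ∀ d a k → m ℕ.^ a ℕ.* Λ d k ≤ Λ d (a ℕ.+ k)
  Λ-shift d zero    k = ≤-reflexive (ℕ.+-identityʳ (Λ d k))
  Λ-shift d (suc a) k = begin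
    m ℕ.* m ℕ.^ a ℕ.* Λ d k     ≡⟨ ℕ.*-assoc m (m ℕ.^ a) (Λ d k) ⟩
    m ℕ.* (m ℕ.^ a ℕ.* Λ d k)   ≤⟨ ℕ.*-monoʳ-≤ m (Λ-shift d a k) ⟩
    m ℕ.* Λ d (a ℕ.+ k)         ≤⟨ Λ-step d (a ℕ.+ k) ⟩
    Λ d (suc a ℕ.+ k)           ∎
    where open ℕ.≤-Reasoning

  Λ-mono : ∀ d k → Λ d k ≤ Λ (suc d) k
  Λ-mono d zero          = ≤-refl
  Λ-mono d (suc zero)    = ≤-refl
  Λ-mono d (suc (suc k)) = ℕ.*-mono-≤ (ℕ.*-monoʳ-≤ m (n≤1+n (d ℕ.+ m))) (Λ-mono d k)

  Λ-even : ∀ d k → Λ d (2 ℕ.* k) ≡ (m ℕ.* (d ℕ.+ m)) ℕ.^ k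
  Λ-even d zero    = refl
  Λ-even d (suc k) = trans (cong (Λ d) (ℕ.+-suc (suc k) (k ℕ.+ 0)))
                           (cong (m ℕ.* (d ℕ.+ m) ℕ.*_) (Λ-even d k))

  module _ .{{_ : NonZero m}} where

    ∣m-1∣≤m : ∣ + m - 1ℤ ∣ ≤ m
    ∣m-1∣≤m = helper m
      where helper : ∀ n → .{{NonZero n}} → ∣ + n - 1ℤ ∣ ≤ n
            helper (suc n) = n≤1+n n

    ∣weight∣≤ : ∀ s → ∣ weight (suc s) ∣ ≤ 2 ℕ.* m ℕ.^ suc s
    ∣weight∣≤ s = begin
      ∣ M₁ * (- 1ℤ) ^ suc s + M₁ ^ suc s ∣         ≤⟨ ∣i+j∣≤∣i∣+∣j∣ (M₁ * (- 1ℤ) ^ suc s) (M₁ ^ suc s) ⟩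
      ∣ M₁ * (- 1ℤ) ^ suc s ∣ ℕ.+ ∣ M₁ ^ suc s ∣   ≡⟨ cong₂ ℕ._+_ (trans (abs-* M₁ _) (cong (∣ M₁ ∣ ℕ.*_) ∣-1^n∣≡1)) (abs-^ M₁ (suc s)) ⟩
      ∣ M₁ ∣ ℕ.* 1 ℕ.+ ∣ M₁ ∣ ℕ.^ suc s            ≤⟨ ℕ.+-mono-≤ (ℕ.*-monoˡ-≤ 1 ∣m-1∣≤m) (ℕ.^-monoˡ-≤ (suc s) ∣m-1∣≤m) ⟩
      m ℕ.* 1 ℕ.+ m ℕ.^ suc s                      ≤⟨ ℕ.+-monoˡ-≤ (m ℕ.^ suc s) (ℕ.*-monoʳ-≤ m (ℕ.m^n>0 m s)) ⟩
      m ℕ.^ suc s ℕ.+ m ℕ.^ suc s                  ≡⟨ cong (m ℕ.^ suc s ℕ.+_) (ℕ.+-identityʳ _) ⟨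
      2 ℕ.* m ℕ.^ suc s                            ∎
      where
        open ℕ.≤-Reasoning
        M₁ : ℤ
        M₁ = + m - 1ℤ
        ∣-1^n∣≡1 : ∣ (- 1ℤ) ^ suc s ∣ ≡ 1
        ∣-1^n∣≡1 = trans (abs-^ (- 1ℤ) (suc s)) (ℕ.^-zeroˡ (suc s))

    MomentBound : ℕ → Set
    MomentBound d = ∀ k → ∣ moment d k ∣ ≤ m ℕ.^ d ℕ.* (κ k ℕ.* Λ d k)

    ∣term∣ : ∀ d p k → ∣ term d p k ∣ ≡ (p C k) ℕ.* (∣ weight (p ∸ k) ∣ ℕ.* ∣ moment d k ∣)
    ∣term∣ d p k = trans (abs-* (+ (p C k) * weight (p ∸ k)) (moment d k))
                         (trans (cong (ℕ._* ∣ moment d k ∣) (abs-* (+ (p C k)) (weight (p ∸ k))))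
                                (ℕ.*-assoc (p C k) _ _))

    lowerTermBound : ℕ → ℕ → ℕ
    lowerTermBound d q = 2 ℕ.* (m ℕ.* m) ℕ.* (m ℕ.^ d ℕ.* (κ q ℕ.* Λ d q))

    ∣term∣≤ : ∀ d → MomentBound d → ∀ q k → k < suc (suc q) →
              ∣ term d (suc (suc q)) k ∣ ≤ (suc (suc q) C k) ℕ.* lowerTermBound d q
    ∣term∣≤ d bound q k (s≤s k≤1+q) with ℕ.m≤n⇒m<n∨m≡n k≤1+q
    ... | inj₂ refl = ≤-trans (≤-reflexive (cong ∣_∣ vanishes)) z≤n
      where
        vanishes : term d (suc (suc q)) (suc q) ≡ 0ℤ
        vanishes = begin
          + (p C suc q) * weight (suc (suc q) ∸ suc q) * moment d (suc q)
            ≡⟨ cong (λ s → + (p C suc q) * weight s * moment d (suc q)) (ℕ.m+n∸n≡m 1 q) ⟩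
          + (p C suc q) * weight 1 * moment d (suc q)
            ≡⟨ cong (λ w → + (p C suc q) * w * moment d (suc q)) weight-one ⟩
          + (p C suc q) * 0ℤ * moment d (suc q)
            ≡⟨ annihilate (+ (p C suc q)) (moment d (suc q)) ⟩
          0ℤ ∎
          where
            open ≡-Reasoning
            p : ℕ
            p = suc (suc q)
            annihilate : ∀ a b → a * 0ℤ * b ≡ 0ℤ
            annihilate = solve-∀
    ... | inj₁ (s≤s k≤q) = begin
      ∣ term d p k ∣
        ≡⟨ ∣term∣ d p k ⟩
      (p C k) ℕ.* (∣ weight (p ∸ k) ∣ ℕ.* ∣ moment d k ∣)
        ≡⟨ cong (λ s → (p C k) ℕ.* (∣ weight s ∣ ℕ.* ∣ moment d k ∣)) (ℕ.+-∸-assoc 2 k≤q) ⟩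
      (p C k) ℕ.* (∣ weight (suc (suc (q ∸ k))) ∣ ℕ.* ∣ moment d k ∣)
        ≤⟨ ℕ.*-monoʳ-≤ (p C k) (ℕ.*-mono-≤ (∣weight∣≤ (suc (q ∸ k))) (bound k)) ⟩
      (p C k) ℕ.* (2 ℕ.* m ℕ.^ suc (suc (q ∸ k)) ℕ.* (m ℕ.^ d ℕ.* (κ k ℕ.* Λ d k)))
        ≡⟨ cong ((p C k) ℕ.*_) (regroup m (m ℕ.^ (q ∸ k)) (m ℕ.^ d) (κ k) (Λ d k)) ⟩
      (p C k) ℕ.* (2 ℕ.* (m ℕ.* m) ℕ.* (m ℕ.^ d ℕ.* (κ k ℕ.* (m ℕ.^ (q ∸ k) ℕ.* Λ d k))))
        ≤⟨ ℕ.*-monoʳ-≤ (p C k) (ℕ.*-monoʳ-≤ (2 ℕ.* (m ℕ.* m)) (ℕ.*-monoʳ-≤ (m ℕ.^ d) (ℕ.*-mono-≤ (κ-mono k≤q) shift))) ⟩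
      (p C k) ℕ.* lowerTermBound d q ∎
      where
        open ℕ.≤-Reasoning
        p : ℕ
        p = suc (suc q)
        regroup : ∀ m mˣ mᵈ a l → 2 ℕ.* (m ℕ.* (m ℕ.* mˣ)) ℕ.* (mᵈ ℕ.* (a ℕ.* l))
                                 ≡ 2 ℕ.* (m ℕ.* m) ℕ.* (mᵈ ℕ.* (a ℕ.* (mˣ ℕ.* l)))
        regroup = ℕSolver.solve-∀
        shift : m ℕ.^ (q ∸ k) ℕ.* Λ d k ≤ Λ d q
        shift = ≤-trans (Λ-shift d (q ∸ k) k) (≤-reflexive (cong (Λ d) (ℕ.m∸n+n≡m k≤q)))

    ∣lower∣≤ : ∀ d → MomentBound d → ∀ q → let p = suc (suc q) in
               ∣ ∑[ k < p ] term d p (toℕ k) ∣ ≤ 2 ℕ.^ p ℕ.* lowerTermBound d q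
    ∣lower∣≤ d bound q = begin
      ∣ ∑[ k < p ] term d p (toℕ k) ∣                   ≤⟨ ∣sum∣≤sum∣∣ {p} (λ k → term d p (toℕ k)) ⟩
      ℕΣ.sum {p} (λ k → ∣ term d p (toℕ k) ∣)            ≤⟨ ℕΣ.sum-mono-≤ (λ k → ∣term∣≤ d bound q (toℕ k) (toℕ<n k)) ⟩
      ℕΣ.sum {p} (λ k → (p C toℕ k) ℕ.* lowerTermBound d q) ≡⟨ ℕΣ.*-distribʳ-sum {p} (lowerTermBound d q) (λ k → p C toℕ k) ⟨
      ℕΣ.sum {p} (λ k → p C toℕ k) ℕ.* lowerTermBound d q ≤⟨ ℕ.*-monoˡ-≤ (lowerTermBound d q) (binomial-sum-init≤ p) ⟩
      2 ℕ.^ p ℕ.* lowerTermBound d q                     ∎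
      where
        open ℕ.≤-Reasoning
        p : ℕ
        p = suc (suc q)

    ∣moment-suc∣≤ : ∀ d p → ∣ moment (suc d) p ∣ ≤ ∣ ∑[ k < p ] term d p (toℕ k) ∣ ℕ.+ m ℕ.* ∣ moment d p ∣
    ∣moment-suc∣≤ d p = begin
      ∣ moment (suc d) p ∣                                         ≡⟨ cong ∣_∣ (moment-suc-split d p) ⟩
      ∣ ∑[ k < p ] term d p (toℕ k) + + m * moment d p ∣          ≤⟨ ∣i+j∣≤∣i∣+∣j∣ (∑[ k < p ] term d p (toℕ k)) (+ m * moment d p) ⟩
      ∣ ∑[ k < p ] term d p (toℕ k) ∣ ℕ.+ ∣ + m * moment d p ∣   ≡⟨ cong (∣ ∑[ k < p ] term d p (toℕ k) ∣ ℕ.+_) (abs-* (+ m) (moment d p)) ⟩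
      ∣ ∑[ k < p ] term d p (toℕ k) ∣ ℕ.+ m ℕ.* ∣ moment d p ∣   ∎
      where open ℕ.≤-Reasoning

    moment-bound-zero : MomentBound 0
    moment-bound-zero zero    = ≤-refl
    moment-bound-zero (suc k) = ≤-trans (≤-reflexive (cong ∣_∣ vanishes)) z≤n
      where
        vanishes : centred 0 0 * centred 0 0 ^ k ≡ 0ℤ
        vanishes = identity (+ m) (centred 0 0 ^ k)
          where identity : ∀ m z → (m * 0ℤ - 0ℤ) * z ≡ 0ℤ
                identity = solve-∀

    moment-bound-suc : ∀ d → MomentBound d → MomentBound (suc d)
    moment-bound-suc d bound zero = begin
      ∣ moment (suc d) 0 ∣                  ≤⟨ ∣moment-suc∣≤ d 0 ⟩
      m ℕ.* ∣ moment d 0 ∣                  ≤⟨ ℕ.*-monoʳ-≤ m (bound 0) ⟩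
      m ℕ.* (m ℕ.^ d ℕ.* (1 ℕ.* 1))         ≡⟨ ℕ.*-assoc m (m ℕ.^ d) 1 ⟨
      m ℕ.^ suc d ℕ.* (κ 0 ℕ.* Λ (suc d) 0) ∎
      where open ℕ.≤-Reasoning
    moment-bound-suc d bound (suc zero) = begin
      ∣ moment (suc d) 1 ∣                                  ≤⟨ ∣moment-suc∣≤ d 1 ⟩
      ∣ term d 1 0 + 0ℤ ∣ ℕ.+ m ℕ.* ∣ moment d 1 ∣          ≡⟨ cong (λ t → ∣ t + 0ℤ ∣ ℕ.+ m ℕ.* ∣ moment d 1 ∣) vanishes ⟩
      m ℕ.* ∣ moment d 1 ∣                                  ≤⟨ ℕ.*-monoʳ-≤ m (bound 1) ⟩
      m ℕ.* (m ℕ.^ d ℕ.* (1 ℕ.* m))                         ≡⟨ ℕ.*-assoc m (m ℕ.^ d) (1 ℕ.* m) ⟨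
      m ℕ.^ suc d ℕ.* (κ 1 ℕ.* Λ (suc d) 1)                 ∎
      where
        open ℕ.≤-Reasoning
        vanishes : term d 1 0 ≡ 0ℤ
        vanishes = trans (cong (λ w → + 1 * w * moment d 0) weight-one) (annihilate (moment d 0))
          where annihilate : ∀ b → + 1 * 0ℤ * b ≡ 0ℤ
                annihilate = solve-∀
    moment-bound-suc d bound (suc (suc q)) = begin
      ∣ moment (suc d) p ∣
        ≤⟨ ∣moment-suc∣≤ d p ⟩
      ∣ ∑[ k < p ] term d p (toℕ k) ∣ ℕ.+ m ℕ.* ∣ moment d p ∣
        ≤⟨ ℕ.+-mono-≤ (∣lower∣≤ d bound q) (ℕ.*-monoʳ-≤ m (bound p)) ⟩
      2 ℕ.^ p ℕ.* lowerTermBound d q ℕ.+ m ℕ.* (m ℕ.^ d ℕ.* (κ p ℕ.* Λ d p))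
        ≡⟨ regroup m (m ℕ.^ d) (2 ℕ.^ p) (κ q) (Λ d q) d ⟩
      m ℕ.^ suc d ℕ.* (κ p ℕ.* (m ℕ.* (suc d ℕ.+ m) ℕ.* Λ d q))
        ≤⟨ ℕ.*-monoʳ-≤ (m ℕ.^ suc d) (ℕ.*-monoʳ-≤ (κ p) (ℕ.*-monoʳ-≤ (m ℕ.* (suc d ℕ.+ m)) (Λ-mono d q))) ⟩
      m ℕ.^ suc d ℕ.* (κ p ℕ.* Λ (suc d) p) ∎
      where
        open ℕ.≤-Reasoning
        p : ℕ
        p = suc (suc q)
        regroup : ∀ m mᵈ t a l d →
                  t ℕ.* (2 ℕ.* (m ℕ.* m) ℕ.* (mᵈ ℕ.* (a ℕ.* l))) ℕ.+ m ℕ.* (mᵈ ℕ.* (2 ℕ.* t ℕ.* a ℕ.* (m ℕ.* (d ℕ.+ m) ℕ.* l)))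
                  ≡ m ℕ.* mᵈ ℕ.* (2 ℕ.* t ℕ.* a ℕ.* (m ℕ.* (suc d ℕ.+ m) ℕ.* l))
        regroup = ℕSolver.solve-∀

    moment-bound : ∀ d → MomentBound d
    moment-bound zero    = moment-bound-zero
    moment-bound (suc d) = moment-bound-suc d (moment-bound d)

module Concentration where

  open Counting
  open MomentConstant using (κ)
  open FactorialMoments using (factorial-moment)
  open FallingFactorial using (falling; P′≡falling)
  open FallingBasis using (Linear; proportional-on-centredPower)
  open Integers using (pos-sum; pos-^; abs-^; even-power≡∣∣)
  open import Data.Nat as ℕ using (_+_; _*_; _^_; _≤_; _<_; zero; suc; NonZero)
  import Data.Nat.Properties as ℕ
  open import Data.Nat.Combinatorics.Base using (_P′_)
  open import Data.Integer as ℤ using (ℤ; +_; ∣_∣)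
  import Data.Integer.Properties as ℤ
  open import Data.Integer.Tactic.RingSolver using (solve-∀)
  import Data.Nat.Tactic.RingSolver as ℕSolver
  open import Data.Fin using (Fin)
  open import Data.Bool using (Bool; true; false; _∧_)
  open import Data.Empty using (⊥-elim)
  open import Relation.Nullary using (yes; no)
  open import Relation.Binary.PropositionalEquality
  open import Algebra.Properties.Semiring.Sum ℤ.+-*-semiring as ℤΣ using ()
  open import Algebra.Properties.CommutativeSemigroup ℕ.*-commutativeSemigroup using (x∙yz≈y∙xz; interchange)

  deviates⇒ : ∀ {a d x} → Deviates a d x ≡ true → a ^ 7 ≤ ∣ FallingBasis.centred a d x ∣
  deviates⇒ {a} {d} {x} dev with a ^ 7 ℕ.≤? ∣ + (x * a) ℤ.- + d ∣
  ... | yes a⁷≤ = subst (λ y → a ^ 7 ≤ ∣ y ℤ.- + d ∣) (trans (ℤ.pos-* x a) (ℤ.*-comm (+ x) (+ a))) a⁷≤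

  small⇒¬deviates : ∀ {a d x} → x * a + d < a ^ 7 → Deviates a d x ≡ false
  small⇒¬deviates {a} {d} {x} small with a ^ 7 ℕ.≤? ∣ + (x * a) ℤ.- + d ∣
  ... | yes a⁷≤ = ⊥-elim (ℕ.<⇒≱ (ℕ.≤-<-trans ∣x-y∣≤x+y small) a⁷≤)
    where
      ∣x-y∣≤x+y : ∣ + (x * a) ℤ.- + d ∣ ≤ x * a + d
      ∣x-y∣≤x+y = ℕ.≤-trans (ℤ.∣i+j∣≤∣i∣+∣j∣ (+ (x * a)) (ℤ.- + d)) (ℕ.≤-reflexive (cong (λ y → x * a + y) (ℤ.∣-i∣≡∣i∣ (+ d))))
  ... | no _    = refl

  module _ {n m K c} .{{_ : NonZero m}} (H : Fin (suc K) → Fin n → Fin m) (H-independent : CWiseIndependent c H)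
           (c≤n : c ≤ n) (G : Graph n) (v : Fin n) where

    open BinomialMoments m using (Bin; Bin-linear; Bin-basis; basis; centred; moment; Λ; moment-bound)

    private
      d : ℕ
      d = degree G v

      X : Fin (suc K) → ℕ
      X i = degree' G (H i) v

    familySum : (ℕ → ℤ) → ℤ
    familySum f = ℤΣ.sum (λ i → f (X i))

    familySum-linear : Linear familySum
    familySum-linear = record
      { cong-≗      = λ f≗g → ℤΣ.sum-cong-≗ (λ i → f≗g (X i))
      ; additive    = λ f g → ℤΣ.∑-distrib-+ (λ i → f (X i)) (λ i → g (X i))
      ; homogeneous = λ a f → sym (ℤΣ.*-distribˡ-sum a (λ i → f (X i)))
      }

    familySum-basis : ∀ j → suc j ≤ c → familySum (basis j) ≡ + (suc K * (d P′ j))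
    familySum-basis j j<c = begin
      ℤΣ.sum (λ i → falling (+ X i) j ℤ.* (+ m) ℤ.^ j)
        ≡⟨ ℤΣ.sum-cong-≗ (λ i → sym (trans (ℤ.pos-* (X i P′ j) (m ^ j)) (cong₂ ℤ._*_ (P′≡falling (X i) j) (pos-^ m j)))) ⟩
      ℤΣ.sum (λ i → + ((X i P′ j) * m ^ j))
        ≡⟨ pos-sum (λ i → (X i P′ j) * m ^ j) ⟨
      + (∑[ i < suc K ] ((X i P′ j) * m ^ j))
        ≡⟨ cong +_ (*-distribʳ-sum (m ^ j) (λ i → X i P′ j)) ⟨
      + ((∑[ i < suc K ] (X i P′ j)) * m ^ j)
        ≡⟨ cong +_ (factorial-moment H H-independent c≤n G v j j<c) ⟩
      + (suc K * (d P′ j)) ∎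
      where open ≡-Reasoning

    familySum-proportional-Bin : ∀ j → suc j ≤ c → (+ m) ℤ.^ d ℤ.* familySum (basis j) ≡ + suc K ℤ.* Bin d (basis j)
    familySum-proportional-Bin j j<c = begin
      (+ m) ℤ.^ d ℤ.* familySum (basis j)                ≡⟨ cong ((+ m) ℤ.^ d ℤ.*_) (trans (familySum-basis j j<c) (ℤ.pos-* (suc K) (d P′ j))) ⟩
      (+ m) ℤ.^ d ℤ.* (+ suc K ℤ.* + (d P′ j))   ≡⟨ swap ((+ m) ℤ.^ d) (+ suc K) (+ (d P′ j)) ⟩
      + suc K ℤ.* ((+ m) ℤ.^ d ℤ.* + (d P′ j))   ≡⟨ cong (λ f → + suc K ℤ.* ((+ m) ℤ.^ d ℤ.* f)) (P′≡falling d j) ⟩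
      + suc K ℤ.* ((+ m) ℤ.^ d ℤ.* falling (+ d) j) ≡⟨ cong (+ suc K ℤ.*_) (Bin-basis d j) ⟨
      + suc K ℤ.* Bin d (basis j)                ∎
      where
        open ≡-Reasoning
        swap : ∀ a b c → a ℤ.* (b ℤ.* c) ≡ b ℤ.* (a ℤ.* c)
        swap = solve-∀

    even-moment≤ : ∀ k → suc (2 * k) ≤ c →
                   ∑[ i < suc K ] (∣ centred d (X i) ∣ ^ (2 * k)) ≤ suc K * (κ (2 * k) * Λ d (2 * k))
    even-moment≤ k 2k<c = ℕ.*-cancelˡ-≤ (m ^ d) {{ℕ.m^n≢0 m d}} (begin
      m ^ d * ∑[ i < suc K ] (∣ centred d (X i) ∣ ^ p)
        ≡⟨ cong (m ^ d *_) (cong ∣_∣ familySum-centred-power) ⟩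
      m ^ d * ∣ familySum (λ x → centred d x ℤ.^ p) ∣
        ≡⟨ cong (_* ∣ familySum (λ x → centred d x ℤ.^ p) ∣) (abs-^ (+ m) d) ⟨
      ∣ (+ m) ℤ.^ d ∣ * ∣ familySum (λ x → centred d x ℤ.^ p) ∣
        ≡⟨ ℤ.abs-* ((+ m) ℤ.^ d) (familySum (λ x → centred d x ℤ.^ p)) ⟨
      ∣ (+ m) ℤ.^ d ℤ.* familySum (λ x → centred d x ℤ.^ p) ∣
        ≡⟨ cong ∣_∣ (proportional-on-centredPower m familySum-linear (Bin-linear d) (+ suc K) ((+ m) ℤ.^ d) c familySum-proportional-Bin d p 2k<c) ⟩
      ∣ + suc K ℤ.* moment d p ∣
        ≡⟨ ℤ.abs-* (+ suc K) (moment d p) ⟩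
      suc K * ∣ moment d p ∣
        ≤⟨ ℕ.*-monoʳ-≤ (suc K) (moment-bound d p) ⟩
      suc K * (m ^ d * (κ p * Λ d p))
        ≡⟨ x∙yz≈y∙xz (suc K) (m ^ d) (κ p * Λ d p) ⟩
      m ^ d * (suc K * (κ p * Λ d p)) ∎)
      where
        open ℕ.≤-Reasoning
        p : ℕ
        p = 2 * k
        familySum-centred-power : + (∑[ i < suc K ] (∣ centred d (X i) ∣ ^ p)) ≡ familySum (λ x → centred d x ℤ.^ p)
        familySum-centred-power = trans (pos-sum (λ i → ∣ centred d (X i) ∣ ^ p))
                                (ℤΣ.sum-cong-≗ (λ i → sym (even-power≡∣∣ (centred d (X i)) k)))

    deviation-count≤ : ∀ k → suc (2 * k) ≤ c →
                       count (λ i → Deviates m d (X i)) * (m ^ 7) ^ (2 * k) ≤ suc K * (κ (2 * k) * Λ d (2 * k))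
    deviation-count≤ k 2k<c =
      ℕ.≤-trans (count-markov (λ i → Deviates m d (X i)) (λ i → ∣ centred d (X i) ∣ ^ (2 * k)) ((m ^ 7) ^ (2 * k))
                              (λ i dev → ℕ.^-monoˡ-≤ (2 * k) (deviates⇒ {m} {d} {X i} dev)))
                (even-moment≤ k 2k<c)

  ^-distribʳ-* : ∀ a b n → (a * b) ^ n ≡ a ^ n * b ^ n
  ^-distribʳ-* a b zero    = refl
  ^-distribʳ-* a b (suc n) = trans (cong (a * b *_) (^-distribʳ-* a b n)) (interchange a b (a ^ n) (b ^ n))

  scale≤ : ∀ {m d} .{{_ : NonZero m}} → d ≤ m ^ 10 + m ^ 7 → m * (d + m) ≤ 3 * m ^ 11
  scale≤ {m} {d} d≤ = begin
    m * (d + m)                              ≤⟨ ℕ.*-monoʳ-≤ m (ℕ.+-mono-≤ (ℕ.≤-trans d≤ (ℕ.+-monoʳ-≤ (m ^ 10) m⁷≤m¹⁰)) m≤m¹⁰) ⟩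
    m * (m ^ 10 + m ^ 10 + m ^ 10)           ≡⟨ identity m (m ^ 10) ⟩
    3 * m ^ 11                               ∎
    where
      open ℕ.≤-Reasoning
      m⁷≤m¹⁰ : m ^ 7 ≤ m ^ 10
      m⁷≤m¹⁰ = ℕ.^-monoʳ-≤ m {7} {10} (ℕ.m≤m+n 7 3)
      m≤m¹⁰ : m ≤ m ^ 10
      m≤m¹⁰ = ℕ.≤-trans (ℕ.≤-reflexive (sym (ℕ.*-identityʳ m))) (ℕ.^-monoʳ-≤ m {1} {10} (ℕ.m≤m+n 1 9))
      identity : ∀ m y → m * (y + y + y) ≡ 3 * (m * y)
      identity = ℕSolver.solve-∀


  concentration : ∀ {n m K c} .{{_ : NonZero m}} (H : Fin (suc K) → Fin n → Fin m) → CWiseIndependent c H → c ≤ n →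
                  (G : Graph n) (v : Fin n) → degree G v ≤ m ^ 10 + m ^ 7 →
                  ∀ k → suc (2 * suc k) ≤ c → κ (2 * suc k) * 3 ^ suc k ≤ m ^ 3 →
                  count (λ i → Deviates m (degree G v) (degree' G (H i) v)) * m ^ (3 * k) ≤ suc K
  concentration {n} {m} {K} H H-independent c≤n G v d≤ k 2k<c κ≤ =
    ℕ.*-cancelʳ-≤ (count deviates * m ^ (3 * k)) (suc K) (m ^ (3 + 11 * suc k)) {{ℕ.m^n≢0 m (3 + 11 * suc k)}} (begin
    count deviates * m ^ (3 * k) * m ^ (3 + 11 * suc k)
      ≡⟨ ℕ.*-assoc (count deviates) (m ^ (3 * k)) (m ^ (3 + 11 * suc k)) ⟩
    count deviates * (m ^ (3 * k) * m ^ (3 + 11 * suc k))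
      ≡⟨ cong (count deviates *_) exponent ⟩
    count deviates * (m ^ 7) ^ (2 * suc k)
      ≤⟨ deviation-count≤ H H-independent c≤n G v (suc k) 2k<c ⟩
    suc K * (κ′ * Λ d (2 * suc k))
      ≡⟨ cong (λ l → suc K * (κ′ * l)) (Λ-even d (suc k)) ⟩
    suc K * (κ′ * (m * (d + m)) ^ suc k)
      ≤⟨ ℕ.*-monoʳ-≤ (suc K) (ℕ.*-monoʳ-≤ κ′ (ℕ.^-monoˡ-≤ (suc k) (scale≤ d≤))) ⟩
    suc K * (κ′ * (3 * m ^ 11) ^ suc k)
      ≡⟨ cong (λ x → suc K * (κ′ * x)) power-split ⟩
    suc K * (κ′ * (3 ^ suc k * m ^ (11 * suc k)))
      ≡⟨ cong (suc K *_) (sym (ℕ.*-assoc κ′ (3 ^ suc k) (m ^ (11 * suc k)))) ⟩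
    suc K * (κ′ * 3 ^ suc k * m ^ (11 * suc k))
      ≤⟨ ℕ.*-monoʳ-≤ (suc K) (ℕ.*-monoˡ-≤ (m ^ (11 * suc k)) κ≤) ⟩
    suc K * (m ^ 3 * m ^ (11 * suc k))
      ≡⟨ cong (suc K *_) (sym (ℕ.^-distribˡ-+-* m 3 (11 * suc k))) ⟩
    suc K * m ^ (3 + 11 * suc k) ∎)
    where
      open ℕ.≤-Reasoning
      open BinomialMoments m using (Λ; Λ-even)
      d : ℕ
      d = degree G v
      κ′ : ℕ
      κ′ = κ (2 * suc k)
      deviates : Fin (suc K) → Bool
      deviates i = Deviates m d (degree' G (H i) v)
      power-split : (3 * m ^ 11) ^ suc k ≡ 3 ^ suc k * m ^ (11 * suc k)
      power-split = trans (^-distribʳ-* 3 (m ^ 11) (suc k)) (cong (3 ^ suc k *_) (ℕ.^-*-assoc m 11 (suc k)))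
      exponent : m ^ (3 * k) * m ^ (3 + 11 * suc k) ≡ (m ^ 7) ^ (2 * suc k)
      exponent = begin-equality
        m ^ (3 * k) * m ^ (3 + 11 * suc k) ≡⟨ ℕ.^-distribˡ-+-* m (3 * k) (3 + 11 * suc k) ⟨
        m ^ (3 * k + (3 + 11 * suc k))     ≡⟨ cong (m ^_) (identity k) ⟩
        m ^ (7 * (2 * suc k))              ≡⟨ ℕ.^-*-assoc m 7 (2 * suc k) ⟨
        (m ^ 7) ^ (2 * suc k)              ∎
        where identity : ∀ k → 3 * k + (3 + 11 * suc k) ≡ 7 * (2 * suc k)
              identity = ℕSolver.solve-∀

  noise<m⁷ : ∀ {m x d} → 23 ≤ m → x ≤ 22 → d ≤ 22 → x * m + d < m ^ 7
  noise<m⁷ {m} {x} {d} 23≤m x≤22 d≤22 = begin-strict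
    x * m + d        ≤⟨ ℕ.+-mono-≤ (ℕ.*-monoˡ-≤ m x≤22) d≤22 ⟩
    22 * m + 22      <⟨ ℕ.+-monoʳ-< (22 * m) 23≤m ⟩
    22 * m + m       ≡⟨ ℕ.+-comm (22 * m) m ⟩
    23 * m           ≤⟨ ℕ.*-monoˡ-≤ m 23≤m ⟩
    m * m            ≤⟨ ℕ.*-monoʳ-≤ m (ℕ.≤-trans (ℕ.≤-reflexive (sym (ℕ.*-identityʳ m))) (ℕ.^-monoʳ-≤ m {1} {6} (ℕ.m≤m+n 1 5))) ⟩
    m ^ 7            ∎
    where
      open ℕ.≤-Reasoning
      instance
        m≢0 : NonZero m
        m≢0 = ℕ.>-nonZero (ℕ.<-≤-trans (ℕ.s≤s ℕ.z≤n) 23≤m)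

  -- On at most 22 nodes 23-wise independence is vacuous, but then degrees are too small to deviate.
  small-graph : ∀ {n m K} (H : Fin (suc K) → Fin n → Fin m) (G : Graph n) (v : Fin n) → n ≤ 22 → 23 ≤ m →
                count (λ i → Deviates m (degree G v) (degree' G (H i) v)) ≡ 0
  small-graph {m = m} H G v n≤22 23≤m = count-none (λ i → Deviates m (degree G v) (degree' G (H i) v)) (λ i →
    small⇒¬deviates {m} {degree G v} {degree' G (H i) v} (noise<m⁷ 23≤m (tiny (λ u → adj G v u ∧ (H i u == H i v))) (tiny (adj G v))))
    where
      tiny : ∀ P → count P ≤ 22
      tiny P = ℕ.≤-trans (count≤size P) n≤22

open MomentConstant using (κ)
open Concentration using (concentration; small-graph)
open import Data.Nat using (suc; _+_; _*_; _^_; _≤_; z≤n; NonZero; >-nonZero; _≤?_)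
open import Data.Nat.Properties using (≤-trans; ≤-reflexive; ≤-refl; ≤ᵇ⇒≤; ^-monoˡ-≤; ≤-pred; ≰⇒>)
open import Data.Fin using (Fin)
open import Data.Product using (Σ; _,_)
open import Data.Unit using (tt)
open import Relation.Nullary using (yes; no)
open import Relation.Binary.PropositionalEquality using (cong)

κ₂₂-threshold : ∀ {m} → 2 ^ 54 ≤ m → κ (2 * suc 10) * 3 ^ suc 10 ≤ m ^ 3
κ₂₂-threshold 2⁵⁴≤m = ≤-trans (≤ᵇ⇒≤ (κ 22 * 3 ^ 11) ((2 ^ 54) ^ 3) tt) (^-monoˡ-≤ 3 2⁵⁴≤m)

rare-deviation : (m : ℕ) → 2 ^ 54 ≤ m → (n : ℕ) (G : Graph n) → ((v : Fin n) → degree G v ≤ m ^ 10 + m ^ 7) →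
                 (K : ℕ) (H : Fin (suc K) → Fin n → Fin m) → CWiseIndependent 23 H → (v : Fin n) →
                 count (λ i → Deviates m (degree G v) (degree' G (H i) v)) * m ^ 30 ≤ suc K
rare-deviation m 2⁵⁴≤m n G degree≤ K H H-independent v with 23 ≤? n
... | yes 23≤n = concentration H H-independent 23≤n G v (degree≤ v) 10 ≤-refl (κ₂₂-threshold 2⁵⁴≤m)
  where instance
    m≢0 : NonZero m
    m≢0 = >-nonZero (≤-trans (≤ᵇ⇒≤ 1 (2 ^ 54) tt) 2⁵⁴≤m)
... | no  23≰n = ≤-trans (≤-reflexive (cong (_* m ^ 30) (small-graph H G v (≤-pred (≰⇒> 23≰n)) 23≤m))) z≤n
  where
    23≤m : 23 ≤ m
    23≤m = ≤-trans (≤ᵇ⇒≤ 23 (2 ^ 54) tt) 2⁵⁴≤m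

lemma3p5 : Σ ℕ λ c → Σ ℕ λ m₀ →
    (m : ℕ) → m₀ ≤ m →
    (n : ℕ) (G : Graph n) →
    ((v : Fin n) → degree G v ≤ m ^ 10 + m ^ 7) →
    (K : ℕ) (H : Fin (suc K) → Fin n → Fin m) →
    CWiseIndependent c H →
    (v : Fin n) →
    count (λ i → Deviates m (degree G v) (degree' G (H i) v)) * m ^ 30 ≤ suc K
lemma3p5 = 23 , 2 ^ 54 , rare-deviation
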